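{- Let $m$ be a positive integer, let $B$ be a Ferrers board, let $N=|B|$, and write $B=(b_0,\dots,b_N)$ by padding with columns of height $0$ on the left. Let $n(\omega_m(B))=(n_0,n_1,\dots)$. The number of Ferrers boards in the $m$-weight file equivalence class of $B$ is $$ \prod_{i\ge 1} \binom{n_i+n_{i-1}+\dots+n_{i-m}-1}{n_i}, $$ where $n_j=0$ for $j<0$.
   Context: Ferrers boards are written $(b_0,b_1,\dots,b_n)$ with $b_0=0\le b_1\le\dots\le b_n$ integers, the board being the set of the $b_j$ lowest cells of column $j$ in the quadrant grid (boards are sets of cells; left zero columns do not change the board); $|B|$ is the number of cells. $\omega_m(B)=(-b_0,m-b_1,2m-b_2,\dots,nm-b_n)$. For a vector $\nu$ of nonnegative integers, $n(\nu)=(n_0,n_1,\dots)$ where $n_i$ is the number of entries equal to $i$. A file placement on $B$ is a set of cells (rooks) no two in the same column; with $y_i$ rooks in row $i$, $\mathrm{wt}_m F=\prod_i 1\downarrow_{y_i,m}$, where $x\downarrow_{y,m}=x(x-m)\cdots(x-(y-1)m)$, $x\downarrow_{0,m}=1$; $f_{k,m}(B)=\sum_F\mathrm{wt}_m F$ over file placements with $k$ rooks. $B,B'$ are $m$-weight file equivalent if $f_{k,m}(B)=f_{k,m}(B')$ for all $k$. -}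

module Defs where

open import Data.Nat as ℕ using (ℕ; zero; suc; _+_; _*_; _∸_; _≤_; _<_; _≟_)
open import Data.Nat.Combinatorics using (_C_)
open import Data.Integer as ℤ using (ℤ)
open import Data.Nat.ListAction using (sum; product)
open import Relation.Nullary using (yes; no)
open import Data.List using (List; []; _∷_; length; map; filter; upTo; replicate; _++_; zipWith; foldr; concatMap)
open import Data.List.Relation.Unary.All using (All)
open import Data.List.Relation.Unary.Linked using (Linked)
open import Data.Maybe using (Maybe; just; nothing)
open import Data.Product using (_×_)
open import Relation.Binary.PropositionalEquality using (_≡_)

-- A Ferrers board is represented canonically by the list of its NONZERO
-- column heights, left to right (b_1 ≤ … ≤ b_n, all > 0).  Since left
-- zero columns do not change the board, distinct such lists are exactly
-- distinct boards.

IsFerrers : List ℕ → Set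
IsFerrers h = Linked _≤_ h × All (0 <_) h

cells : List ℕ → ℕ
cells = sum

-- File placements.
-- A file placement chooses, for each column of height b, either no rook
-- or a rook in one row r with r < b (rows numbered 0,1,… from the bottom).

columnChoices : ℕ → List (Maybe ℕ)
columnChoices b = nothing ∷ map just (upTo b)

filePlacements : List ℕ → List (List (Maybe ℕ))
filePlacements []      = [] ∷ []
filePlacements (b ∷ h) =
  concatMap (λ c → map (c ∷_) (filePlacements h)) (columnChoices b)

isJust? : Maybe ℕ → ℕ
isJust? nothing  = 0
isJust? (just _) = 1

rooks : List (Maybe ℕ) → ℕ
rooks F = sum (map isJust? F)

inRow : ℕ → Maybe ℕ → ℕ
inRow i nothing = 0
inRow i (just r) with r ≟ i
... | yes _ = 1
... | no  _ = 0

rowCount : List (Maybe ℕ) → ℕ → ℕ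
rowCount F i = sum (map (inRow i) F)

-- x ↓_{y,m} evaluated at x = 1 :  1 (1-m) (1-2m) ⋯ (1-(y-1)m)  (an integer)
fall1 : (m y : ℕ) → ℤ
fall1 m zero    = ℤ.+ 1
fall1 m (suc y) = fall1 m y ℤ.* (ℤ.+ 1 ℤ.- ℤ.+ (y * m))

productℤ : List ℤ → ℤ
productℤ = foldr ℤ._*_ (ℤ.+ 1)

sumℤ : List ℤ → ℤ
sumℤ = foldr ℤ._+_ (ℤ.+ 0)

-- wt_m F = ∏_i 1↓_{y_i,m}.  All rooks lie in rows < cells h (any row
-- index ≥ every height works; rows without rooks contribute 1).
wt : ℕ → List ℕ → List (Maybe ℕ) → ℤ
wt m h F = productℤ (map (λ i → fall1 m (rowCount F i)) (upTo (cells h)))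

f : ℕ → ℕ → List ℕ → ℤ
f k m h = sumℤ (map (wt m h) (filter (λ F → rooks F ≟ k) (filePlacements h)))

FileEquiv : ℕ → List ℕ → List ℕ → Set
FileEquiv m h h' = ∀ k → f k m h ≡ f k m h'

padded : List ℕ → List ℕ
padded h = replicate (suc (cells h) ∸ length h) 0 ++ h

-- entries j m - b_j (these are always ≥ 0, so truncated subtraction is exact)
omega : ℕ → List ℕ → List ℕ
omega m h = zipWith (λ j bj → j * m ∸ bj) (upTo (suc (cells h))) (padded h)

count : List ℕ → ℕ → ℕ
count ν i = length (filter (_≟ i) ν)

range : ℕ → ℕ → List ℕ
range a b = map (a +_) (upTo (suc (b ∸ a)))

window : ℕ → List ℕ → ℕ → ℕ
window m ν i = sum (map (count ν) (range (i ∸ m) i))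

-- ∏_{i ≥ 1} C(n_i + ⋯ + n_{i-m} - 1, n_i).  Every entry of ω_m(B) is
-- ≤ N m, so n_i = 0 for i > N m and those factors equal C(·,0) = 1.
classSize : ℕ → List ℕ → ℕ
classSize m h =
  product (map (λ i → (window m ν i ∸ 1) C count ν i) (range 1 (cells h * m)))
  where ν = omega m h

-- (1) Equivalence means equal multisets ω.  Splitting the file placements
-- at a column gives a column recursion for the weighted file numbers f_{k,m}
-- (rookSum≡rookRec).  Adding a last column multiplies by a linear factor in
-- the falling-factorial basis x↓_{l,m}, so f_{k,m}(B) is the k-th
-- coefficient of ∏_j (x - ω_j) in that basis (f≡rootCoeffs-omega).  These
-- coefficients do not depend on the order of the roots and determine them
-- (evaluate at a root and cancel its factor), hence B ~ B′ iff ω_m(B) and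
-- ω_m(B′) are rearrangements of each other (equiv⇒omega-↭, omega-↭⇒equiv).
--
-- (2) Counting.  ω is a bijection from Ferrers boards with N cells to
-- m-paths (sequences starting at 0 and climbing by at most m per step) with
-- N + 1 entries summing with the columns to the line (omega-toBoard,
-- toBoard-omega).  The m-paths with multiplicities n_0, n_1, … are built
-- value by value: the n_V copies of V go in runs right after entries in
-- V - m, …, V - 1, so every path for the smaller values has
-- C(n_{V-1} + ⋯ + n_{V-m} + n_V - 1, n_V) extensions (length-paths).
module Submission where

open import Defs
open import Data.Bool using (Bool; true; false; if_then_else_)
open import Data.Empty using (⊥-elim)
open import Data.Integer using (ℤ; +_) renaming (_+_ to _+ℤ_; _*_ to _*ℤ_; _-_ to _-ℤ_)
import Data.Integer.Properties as ZP
open import Algebra.Properties.AbelianGroup ZP.+-0-abelianGroup using () renaming (∙-cancelʳ to +-cancelʳ)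
open import Data.Integer.Tactic.RingSolver using (solve-∀)
open import Data.List using (List; []; _∷_; _++_; _∷ʳ_; length; replicate; map; concat; concatMap; filter; foldr; upTo; applyUpTo; zipWith)
import Data.List.Properties as LP
open import Data.List.Membership.Propositional using (_∈_; _∉_)
import Data.List.Membership.Propositional.Properties as MP
open import Data.List.Relation.Binary.Permutation.Propositional as Perm using (_↭_; ↭-sym; ↭-trans)
import Data.List.Relation.Binary.Permutation.Propositional.Properties as PermP
open import Data.List.Relation.Unary.All as All using (All; []; _∷_)
import Data.List.Relation.Unary.All.Properties as AllP
open import Data.List.Relation.Unary.AllPairs using ([]; _∷_)
open import Data.List.Relation.Unary.Any using (here; there)
open import Data.List.Relation.Unary.Linked as Linked using (Linked; []; [-]; _∷_)
import Data.List.Relation.Unary.Linked.Properties as LinkedP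
open import Data.List.Relation.Unary.Unique.Propositional using (Unique)
import Data.List.Relation.Unary.Unique.Propositional.Properties as UP
open import Data.List.Reverse using (Reverse; []; _∶_∶ʳ_; reverseView)
open import Data.Maybe using (Maybe; just; nothing)
open import Data.Nat as ℕ using (ℕ; zero; suc; _+_; _*_; _∸_; _≤_; _<_; _≤?_; _<?_; z≤n; s≤s)
open import Data.Nat.Combinatorics using (_C_; k>n⇒nCk≡0; nCk+nC[k+1]≡[n+1]C[k+1])
open import Data.Nat.ListAction using (sum; product)
open import Data.Nat.ListAction.Properties using (sum-++; sum-↭)
import Data.Nat.Properties as NP
import Data.Nat.Tactic.RingSolver as ℕ-Solver
open import Data.Product as Prod using (Σ; ∃; _×_; _,_; proj₁; proj₂)
open import Data.Sum as Sum using (_⊎_; inj₁; inj₂)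
open import Data.Unit using (⊤; tt)
open import Function using (id; _∘_)
open import Relation.Nullary using (¬_; Dec; yes; no; does)
open import Relation.Nullary.Decidable using (_×-dec_; dec-true)
open import Relation.Binary.PropositionalEquality using (_≡_; _≢_; _≗_; refl; sym; trans; cong; cong₂; subst; module ≡-Reasoning)

module RangeFold {A : Set} (_∙_ : A → A → A) (ε : A)
  (assoc : ∀ x y z → (x ∙ y) ∙ z ≡ x ∙ (y ∙ z))
  (comm : ∀ x y → x ∙ y ≡ y ∙ x)
  (identityˡ : ∀ x → ε ∙ x ≡ x) where

  identityʳ : ∀ x → x ∙ ε ≡ x
  identityʳ x = trans (comm x ε) (identityˡ x)

  fold : (ℕ → A) → ℕ → A
  fold g zero    = ε
  fold g (suc n) = fold g n ∙ g n

  foldr-++ : ∀ xs ys → foldr _∙_ ε (xs ++ ys) ≡ foldr _∙_ ε xs ∙ foldr _∙_ ε ys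
  foldr-++ []       ys = sym (identityˡ _)
  foldr-++ (x ∷ xs) ys = trans (cong (x ∙_) (foldr-++ xs ys)) (sym (assoc x _ _))

  fold-upTo : ∀ (g : ℕ → A) n → foldr _∙_ ε (map g (upTo n)) ≡ fold g n
  fold-upTo g zero    = refl
  fold-upTo g (suc n) = begin
    foldr _∙_ ε (map g (upTo (suc n)))      ≡⟨ cong (λ l → foldr _∙_ ε (map g l)) (sym (LP.upTo-∷ʳ n)) ⟩
    foldr _∙_ ε (map g (upTo n ++ n ∷ []))   ≡⟨ cong (foldr _∙_ ε) (LP.map-++ g (upTo n) (n ∷ [])) ⟩
    foldr _∙_ ε (map g (upTo n) ++ g n ∷ []) ≡⟨ foldr-++ (map g (upTo n)) (g n ∷ []) ⟩
    foldr _∙_ ε (map g (upTo n)) ∙ (g n ∙ ε) ≡⟨ cong₂ _∙_ (fold-upTo g n) (identityʳ (g n)) ⟩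
    fold g n ∙ g n                           ∎
    where open ≡-Reasoning

  fold-cong : ∀ {g g′ : ℕ → A} n → (∀ i → i < n → g i ≡ g′ i) → fold g n ≡ fold g′ n
  fold-cong zero    e = refl
  fold-cong (suc n) e = cong₂ _∙_ (fold-cong n (λ i i<n → e i (NP.m<n⇒m<1+n i<n))) (e n NP.≤-refl)

  fold-ε : ∀ n → fold (λ _ → ε) n ≡ ε
  fold-ε zero    = refl
  fold-ε (suc n) = trans (identityʳ _) (fold-ε n)

  fold-∙ : ∀ (g h : ℕ → A) n → fold (λ i → g i ∙ h i) n ≡ fold g n ∙ fold h n
  fold-∙ g h zero    = sym (identityˡ ε)
  fold-∙ g h (suc n) = begin
    fold (λ i → g i ∙ h i) n ∙ (g n ∙ h n) ≡⟨ cong (_∙ (g n ∙ h n)) (fold-∙ g h n) ⟩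
    (G ∙ H) ∙ (g n ∙ h n)                  ≡⟨ assoc G H _ ⟩
    G ∙ (H ∙ (g n ∙ h n))                  ≡⟨ cong (G ∙_) (sym (assoc H (g n) (h n))) ⟩
    G ∙ ((H ∙ g n) ∙ h n)                  ≡⟨ cong (λ z → G ∙ (z ∙ h n)) (comm H (g n)) ⟩
    G ∙ ((g n ∙ H) ∙ h n)                  ≡⟨ cong (G ∙_) (assoc (g n) H (h n)) ⟩
    G ∙ (g n ∙ (H ∙ h n))                  ≡⟨ sym (assoc G (g n) _) ⟩
    (G ∙ g n) ∙ (H ∙ h n)                  ∎
    where open ≡-Reasoning
          G = fold g n
          H = fold h n

  fold-suc : ∀ (g : ℕ → A) n → fold g (suc n) ≡ g 0 ∙ fold (λ j → g (suc j)) n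
  fold-suc g zero    = trans (identityˡ (g 0)) (sym (identityʳ (g 0)))
  fold-suc g (suc n) = trans (cong (_∙ g (suc n)) (fold-suc g n)) (assoc (g 0) _ _)

open RangeFold _+ℤ_ (+ 0) ZP.+-assoc ZP.+-comm ZP.+-identityˡ
  using () renaming (fold to Σℤ; fold-upTo to sumℤ-upTo; fold-cong to Σℤ-cong; fold-ε to Σℤ-zero;
                     fold-∙ to Σℤ-+; fold-suc to Σℤ-suc; foldr-++ to sumℤ-++)
open RangeFold _*ℤ_ (+ 1) ZP.*-assoc ZP.*-comm ZP.*-identityˡ
  using () renaming (fold to Πℤ; fold-upTo to productℤ-upTo; fold-cong to Πℤ-cong; fold-ε to Πℤ-one)
open RangeFold _+_ 0 NP.+-assoc NP.+-comm NP.+-identityˡ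
  using () renaming (fold to Σℕ; fold-upTo to sum-upTo; fold-cong to Σℕ-cong; fold-ε to Σℕ-zero;
                     fold-∙ to Σℕ-+; fold-suc to Σℕ-suc)
open RangeFold _*_ 1 NP.*-assoc NP.*-comm NP.*-identityˡ
  using () renaming (fold to Πℕ; fold-upTo to product-upTo)

δ : ℕ → ℕ → ℕ
δ x i with x ℕ.≟ i
... | yes _ = 1
... | no  _ = 0

δ-≢ : ∀ {x i} → x ≢ i → δ x i ≡ 0
δ-≢ {x} {i} x≢i with x ℕ.≟ i
... | yes x≡i = ⊥-elim (x≢i x≡i)
... | no  _   = refl

Σℕ-δ-outside : ∀ x a ℓ → (x < a ⊎ a + ℓ ≤ x) → Σℕ (λ t → δ x (a + t)) ℓ ≡ 0
Σℕ-δ-outside x a zero    out = refl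
Σℕ-δ-outside x a (suc ℓ) out with x ℕ.≟ a + ℓ
... | no _  = trans (NP.+-identityʳ _) (Σℕ-δ-outside x a ℓ (Sum.map₂ (NP.≤-trans (NP.+-monoʳ-≤ a (NP.n≤1+n ℓ))) out))
... | yes refl = ⊥-elim (Sum.[ (λ x<a → NP.<⇒≱ x<a (NP.m≤m+n a ℓ))
                             , (λ le → NP.<⇒≱ (NP.+-monoʳ-< a (NP.n<1+n ℓ)) le) ] out)

Σℕ-δ-inside : ∀ x a ℓ → a ≤ x → x < a + ℓ → Σℕ (λ t → δ x (a + t)) ℓ ≡ 1
Σℕ-δ-inside x a zero    a≤x x< = ⊥-elim (NP.<⇒≱ x< (subst (_≤ x) (sym (NP.+-identityʳ a)) a≤x))
Σℕ-δ-inside x a (suc ℓ) a≤x x< with x ℕ.≟ a + ℓ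
... | yes refl = cong (_+ 1) (Σℕ-δ-outside x a ℓ (inj₂ NP.≤-refl))
... | no x≢    = trans (NP.+-identityʳ _) (Σℕ-δ-inside x a ℓ a≤x x<′)
  where x<′ : x < a + ℓ
        x<′ = NP.≤∧≢⇒< (NP.≤-pred (subst (x <_) (NP.+-suc a ℓ) x<)) x≢

Σℕ-vanishing : ∀ (y : ℕ → ℕ) c b → c ≤ b → (∀ i → c ≤ i → y i ≡ 0) → Σℕ y b ≡ Σℕ y c
Σℕ-vanishing y .0 zero    z≤n z = refl
Σℕ-vanishing y c (suc b) c≤sb z with c ℕ.≟ suc b
... | yes refl = refl
... | no c≢    = trans (cong₂ _+_ (Σℕ-vanishing y c b c≤b z) (z b c≤b)) (NP.+-identityʳ _)
  where c≤b = NP.≤-pred (NP.≤∧≢⇒< c≤sb c≢)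

Σℤ-*ʳ : ∀ (g : ℕ → ℤ) (c : ℤ) n → Σℤ (λ i → g i *ℤ c) n ≡ Σℤ g n *ℤ c
Σℤ-*ʳ g c zero    = sym (ZP.*-zeroˡ c)
Σℤ-*ʳ g c (suc n) = trans (cong (_+ℤ (g n *ℤ c)) (Σℤ-*ʳ g c n)) (sym (ZP.*-distribʳ-+ c (Σℤ g n) (g n)))

Πℤ-scaled-at : ∀ (g g′ : ℕ → ℤ) c r n → r < n → g r ≡ c *ℤ g′ r →
  (∀ i → i ≢ r → g i ≡ g′ i) → Πℤ g n ≡ c *ℤ Πℤ g′ n
Πℤ-scaled-at g g′ c r (suc n) r<1+n at-r elsewhere with r ℕ.≟ n
... | yes refl = begin
  Πℤ g r *ℤ g r              ≡⟨ cong₂ _*ℤ_ (Πℤ-cong r (λ i i<r → elsewhere i (NP.<⇒≢ i<r))) at-r ⟩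
  Πℤ g′ r *ℤ (c *ℤ g′ r)     ≡⟨ swap (Πℤ g′ r) c (g′ r) ⟩
  c *ℤ (Πℤ g′ r *ℤ g′ r)     ∎
  where open ≡-Reasoning
        swap : ∀ a c b → a *ℤ (c *ℤ b) ≡ c *ℤ (a *ℤ b)
        swap = solve-∀
... | no r≢n = begin
  Πℤ g n *ℤ g n              ≡⟨ cong₂ _*ℤ_ (Πℤ-scaled-at g g′ c r n r<n at-r elsewhere) (elsewhere n (λ e → r≢n (sym e))) ⟩
  (c *ℤ Πℤ g′ n) *ℤ g′ n     ≡⟨ ZP.*-assoc c _ _ ⟩
  c *ℤ (Πℤ g′ n *ℤ g′ n)     ∎
  where open ≡-Reasoning
        r<n = NP.≤∧≢⇒< (NP.≤-pred r<1+n) r≢n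

-- 1↓_{n,m} continued from a row that already holds a rooks:
-- (1 - a m)(1 - (a+1) m) ⋯ (1 - (a+n-1) m).
fallFrom : ℕ → ℕ → ℕ → ℤ
fallFrom m a zero    = + 1
fallFrom m a (suc n) = fallFrom m a n *ℤ (+ 1 -ℤ + ((a + n) * m))

fall1≡fallFrom : ∀ m n → fall1 m n ≡ fallFrom m 0 n
fall1≡fallFrom m zero    = refl
fall1≡fallFrom m (suc n) = cong (_*ℤ (+ 1 -ℤ + (n * m))) (fall1≡fallFrom m n)

fallFrom-suc : ∀ m a n → fallFrom m a (suc n) ≡ (+ 1 -ℤ + (a * m)) *ℤ fallFrom m (suc a) n
fallFrom-suc m a zero = begin
  + 1 *ℤ (+ 1 -ℤ + ((a + 0) * m)) ≡⟨ ZP.*-identityˡ _ ⟩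
  + 1 -ℤ + ((a + 0) * m)          ≡⟨ cong (λ z → + 1 -ℤ + (z * m)) (NP.+-identityʳ a) ⟩
  + 1 -ℤ + (a * m)                ≡⟨ sym (ZP.*-identityʳ _) ⟩
  (+ 1 -ℤ + (a * m)) *ℤ + 1       ∎
  where open ≡-Reasoning
fallFrom-suc m a (suc n) = begin
  fallFrom m a (suc n) *ℤ (+ 1 -ℤ + ((a + suc n) * m))
    ≡⟨ cong₂ _*ℤ_ (fallFrom-suc m a n) (cong (λ z → + 1 -ℤ + (z * m)) (NP.+-suc a n)) ⟩
  ((+ 1 -ℤ + (a * m)) *ℤ fallFrom m (suc a) n) *ℤ (+ 1 -ℤ + ((suc a + n) * m))
    ≡⟨ ZP.*-assoc (+ 1 -ℤ + (a * m)) _ _ ⟩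
  (+ 1 -ℤ + (a * m)) *ℤ fallFrom m (suc a) (suc n) ∎
  where open ≡-Reasoning

-- Weight of a placement F (rows < R) on top of an occupancy y, where row i
-- already holds y i rooks.  The weight wt of Defs is the empty occupancy.
weightOn : ℕ → ℕ → (ℕ → ℕ) → List (Maybe ℕ) → ℤ
weightOn m R y F = Πℤ (λ i → fallFrom m (y i) (rowCount F i)) R

wt≡weightOn : ∀ m h F → wt m h F ≡ weightOn m (cells h) (λ _ → 0) F
wt≡weightOn m h F =
  trans (cong productℤ (LP.map-cong (λ i → fall1≡fallFrom m (rowCount F i)) (upTo (cells h))))
        (productℤ-upTo (λ i → fallFrom m 0 (rowCount F i)) (cells h))

addRook : (ℕ → ℕ) → ℕ → ℕ → ℕ
addRook y r i = δ r i + y i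

weightOn-just : ∀ m R y r F → r < R →
  weightOn m R y (just r ∷ F) ≡ (+ 1 -ℤ + (y r * m)) *ℤ weightOn m R (addRook y r) F
weightOn-just m R y r F r<R =
  Πℤ-scaled-at (λ i → fallFrom m (y i) (rowCount (just r ∷ F) i)) (λ i → fallFrom m (addRook y r i) (rowCount F i))
               (+ 1 -ℤ + (y r * m)) r R r<R at-r elsewhere
  where
  at-r : fallFrom m (y r) (inRow r (just r) + rowCount F r)
       ≡ (+ 1 -ℤ + (y r * m)) *ℤ fallFrom m (addRook y r r) (rowCount F r)
  at-r with r ℕ.≟ r
  ... | yes _ = fallFrom-suc m (y r) (rowCount F r)
  ... | no r≢r = ⊥-elim (r≢r refl)
  elsewhere : ∀ i → i ≢ r → fallFrom m (y i) (inRow i (just r) + rowCount F i)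
                          ≡ fallFrom m (addRook y r i) (rowCount F i)
  elsewhere i i≢r with r ℕ.≟ i
  ... | yes r≡i = ⊥-elim (i≢r (sym r≡i))
  ... | no  _   = refl

sumℤ-*ˡ : ∀ {A : Set} (c : ℤ) (g : A → ℤ) xs → sumℤ (map (λ x → c *ℤ g x) xs) ≡ c *ℤ sumℤ (map g xs)
sumℤ-*ˡ c g []       = sym (ZP.*-zeroʳ c)
sumℤ-*ˡ c g (x ∷ xs) = trans (cong (c *ℤ g x +ℤ_) (sumℤ-*ˡ c g xs)) (sym (ZP.*-distribˡ-+ c (g x) _))

sumℤ-concat : ∀ {A : Set} (g : A → ℤ) xss → sumℤ (map g (concat xss)) ≡ sumℤ (map (λ xs → sumℤ (map g xs)) xss)
sumℤ-concat g []         = refl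
sumℤ-concat g (xs ∷ xss) = begin
  sumℤ (map g (xs ++ concat xss))          ≡⟨ cong sumℤ (LP.map-++ g xs (concat xss)) ⟩
  sumℤ (map g xs ++ map g (concat xss))    ≡⟨ sumℤ-++ (map g xs) _ ⟩
  sumℤ (map g xs) +ℤ sumℤ (map g (concat xss)) ≡⟨ cong (sumℤ (map g xs) +ℤ_) (sumℤ-concat g xss) ⟩
  sumℤ (map g xs) +ℤ sumℤ (map (λ xs → sumℤ (map g xs)) xss) ∎
  where open ≡-Reasoning

hasRooks : ℕ → List (Maybe ℕ) → ℤ
hasRooks k F = if does (rooks F ℕ.≟ k) then + 1 else + 0

sum-filter≡sum-hasRooks : ∀ (g : List (Maybe ℕ) → ℤ) k Fs →
  sumℤ (map g (filter (λ F → rooks F ℕ.≟ k) Fs)) ≡ sumℤ (map (λ F → hasRooks k F *ℤ g F) Fs)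
sum-filter≡sum-hasRooks g k []       = refl
sum-filter≡sum-hasRooks g k (F ∷ Fs) with rooks F ℕ.≡ᵇ k
... | true  = cong₂ _+ℤ_ (sym (ZP.*-identityˡ (g F))) (sum-filter≡sum-hasRooks g k Fs)
... | false = trans (sum-filter≡sum-hasRooks g k Fs) (sym (ZP.+-identityˡ _))

rookSum : ℕ → ℕ → (ℕ → ℕ) → ℕ → List ℕ → ℤ
rookSum m R y k h = sumℤ (map (λ F → hasRooks k F *ℤ weightOn m R y F) (filePlacements h))

f≡rookSum : ∀ k m h → f k m h ≡ rookSum m (cells h) (λ _ → 0) k h
f≡rookSum k m h =
  trans (sum-filter≡sum-hasRooks (wt m h) k (filePlacements h))
        (cong sumℤ (LP.map-cong (λ F → cong (hasRooks k F *ℤ_) (wt≡weightOn m h F)) (filePlacements h)))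

rookSum-∷ : ∀ m R y k b h → rookSum m R y k (b ∷ h) ≡ rookSum m R y k h +ℤ
  Σℤ (λ r → sumℤ (map (λ F → hasRooks k (just r ∷ F) *ℤ weightOn m R y (just r ∷ F)) (filePlacements h))) b
rookSum-∷ m R y k b h = begin
  sumℤ (map G (map (nothing ∷_) X ++ concat (map (λ c → map (c ∷_) X) (map just (upTo b)))))
    ≡⟨ cong sumℤ (LP.map-++ G (map (nothing ∷_) X) _) ⟩
  sumℤ (map G (map (nothing ∷_) X) ++ map G (concat (map (λ c → map (c ∷_) X) (map just (upTo b)))))
    ≡⟨ sumℤ-++ (map G (map (nothing ∷_) X)) _ ⟩
  sumℤ (map G (map (nothing ∷_) X)) +ℤ sumℤ (map G (concat (map (λ c → map (c ∷_) X) (map just (upTo b)))))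
    ≡⟨ cong₂ _+ℤ_ (cong sumℤ (sym (LP.map-∘ X))) (sumℤ-concat G (map (λ c → map (c ∷_) X) (map just (upTo b)))) ⟩
  rookSum m R y k h +ℤ sumℤ (map (λ xs → sumℤ (map G xs)) (map (λ c → map (c ∷_) X) (map just (upTo b))))
    ≡⟨ cong (λ z → rookSum m R y k h +ℤ sumℤ z) (trans (sym (LP.map-∘ (map just (upTo b)))) (sym (LP.map-∘ (upTo b)))) ⟩
  rookSum m R y k h +ℤ sumℤ (map (λ r → sumℤ (map G (map (just r ∷_) X))) (upTo b))
    ≡⟨ cong (rookSum m R y k h +ℤ_) (trans (cong sumℤ (LP.map-cong (λ r → cong sumℤ (sym (LP.map-∘ X))) (upTo b)))
                                            (sumℤ-upTo _ b)) ⟩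
  rookSum m R y k h +ℤ Σℤ (λ r → sumℤ (map (λ F → G (just r ∷ F)) X)) b ∎
  where open ≡-Reasoning
        X = filePlacements h
        G = λ F → hasRooks k F *ℤ weightOn m R y F

-- The column recursion for weighted rook numbers: rookRec m k s h is the
-- k-th weighted file number of the (nondecreasing) columns h when s rooks
-- already stand in rows below all of them.  A rook in column b then has
-- b - s m weight available, whichever row it takes.
rookRec : ℕ → ℕ → ℕ → List ℕ → ℤ
rookRec m zero    s h       = + 1
rookRec m (suc k) s []      = + 0
rookRec m (suc k) s (b ∷ h) = rookRec m (suc k) s h +ℤ (+ b -ℤ + (s * m)) *ℤ rookRec m k (suc s) h

rookSum-no-rooks : ∀ m R y h → rookSum m R y 0 h ≡ + 1
rookSum-no-rooks m R y [] = trans (ZP.+-identityʳ _) (trans (ZP.*-identityˡ _) (Πℤ-one R))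
rookSum-no-rooks m R y (b ∷ h) = begin
  rookSum m R y 0 (b ∷ h)
    ≡⟨ rookSum-∷ m R y 0 b h ⟩
  rookSum m R y 0 h +ℤ Σℤ (λ r → sumℤ (map (λ F → + 0 *ℤ weightOn m R y (just r ∷ F)) (filePlacements h))) b
    ≡⟨ cong₂ _+ℤ_ (rookSum-no-rooks m R y h) (trans (Σℤ-cong b (λ r _ → no-mass r)) (Σℤ-zero b)) ⟩
  + 1 +ℤ + 0 ∎
  where
  open ≡-Reasoning
  no-mass : ∀ r → sumℤ (map (λ F → + 0 *ℤ weightOn m R y (just r ∷ F)) (filePlacements h)) ≡ + 0
  no-mass r = sumℤ-*ˡ (+ 0) (λ F → weightOn m R y (just r ∷ F)) (filePlacements h)

rookSum-[] : ∀ m R y k → rookSum m R y (suc k) [] ≡ + 0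
rookSum-[] m R y k = trans (ZP.+-identityʳ _) (ZP.*-zeroˡ (weightOn m R y []))

Σℤ-row-factors : ∀ (y : ℕ → ℕ) m b → Σℤ (λ r → + 1 -ℤ + (y r * m)) b ≡ + b -ℤ + (Σℕ y b * m)
Σℤ-row-factors y m zero    = refl
Σℤ-row-factors y m (suc b) = begin
  Σℤ (λ r → + 1 -ℤ + (y r * m)) b +ℤ (+ 1 -ℤ + (y b * m))  ≡⟨ cong (_+ℤ (+ 1 -ℤ + (y b * m))) (Σℤ-row-factors y m b) ⟩
  (+ b -ℤ + (Σℕ y b * m)) +ℤ (+ 1 -ℤ + (y b * m))          ≡⟨ regroup (+ b) (+ (Σℕ y b * m)) (+ 1) (+ (y b * m)) ⟩
  (+ b +ℤ + 1) -ℤ (+ (Σℕ y b * m) +ℤ + (y b * m))          ≡⟨ cong₂ _-ℤ_ (sym (ZP.pos-+ b 1)) (sym (ZP.pos-+ (Σℕ y b * m) (y b * m))) ⟩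
  + (b + 1) -ℤ + (Σℕ y b * m + y b * m)                    ≡⟨ cong₂ (λ u v → + u -ℤ + v) (NP.+-comm b 1) (sym (NP.*-distribʳ-+ m (Σℕ y b) (y b))) ⟩
  + suc b -ℤ + (Σℕ y (suc b) * m)                          ∎
  where open ≡-Reasoning
        regroup : ∀ b Y o y → (b -ℤ Y) +ℤ (o -ℤ y) ≡ (b +ℤ o) -ℤ (Y +ℤ y)
        regroup = solve-∀

Σℕ-addRook : ∀ y r b → r < b → Σℕ (addRook y r) b ≡ suc (Σℕ y b)
Σℕ-addRook y r b r<b = trans (Σℕ-+ (δ r) y b) (cong (_+ Σℕ y b) (Σℕ-δ-inside r 0 b z≤n r<b))

rookSum≡rookRec : ∀ m R h c (y : ℕ → ℕ) s k → Linked _≤_ (c ∷ h) → All (_≤ R) h →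
  (∀ i → c ≤ i → y i ≡ 0) → Σℕ y c ≡ s → rookSum m R y k h ≡ rookRec m k s h
rookSum≡rookRec m R h       c y s zero    _ _ _ _ = rookSum-no-rooks m R y h
rookSum≡rookRec m R []      c y s (suc k) _ _ _ _ = rookSum-[] m R y k
rookSum≡rookRec m R (b ∷ h) c y s (suc k) (c≤b ∷ lk) (b≤R ∷ h≤R) y-low y-sum = begin
  rookSum m R y (suc k) (b ∷ h)
    ≡⟨ rookSum-∷ m R y (suc k) b h ⟩
  rookSum m R y (suc k) h +ℤ Σℤ (λ r → sumℤ (map (λ F → hasRooks k F *ℤ weightOn m R y (just r ∷ F)) X)) b
    ≡⟨ cong₂ _+ℤ_ (rookSum≡rookRec m R h c y s (suc k) (skip lk) h≤R y-low y-sum) (Σℤ-cong b rook-in-row) ⟩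
  rookRec m (suc k) s h +ℤ Σℤ (λ r → (+ 1 -ℤ + (y r * m)) *ℤ rookRec m k (suc s) h) b
    ≡⟨ cong (rookRec m (suc k) s h +ℤ_) (Σℤ-*ʳ (λ r → + 1 -ℤ + (y r * m)) (rookRec m k (suc s) h) b) ⟩
  rookRec m (suc k) s h +ℤ Σℤ (λ r → + 1 -ℤ + (y r * m)) b *ℤ rookRec m k (suc s) h
    ≡⟨ cong (λ z → rookRec m (suc k) s h +ℤ z *ℤ rookRec m k (suc s) h)
            (trans (Σℤ-row-factors y m b) (cong (λ z → + b -ℤ + (z * m)) y-sum-b)) ⟩
  rookRec m (suc k) s (b ∷ h) ∎
  where
  open ≡-Reasoning
  X = filePlacements h
  skip : ∀ {h} → Linked _≤_ (b ∷ h) → Linked _≤_ (c ∷ h)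
  skip [-]          = [-]
  skip (b≤x ∷ rest) = NP.≤-trans c≤b b≤x ∷ rest
  y-sum-b : Σℕ y b ≡ s
  y-sum-b = trans (Σℕ-vanishing y c b c≤b y-low) y-sum
  rook-in-row : ∀ r → r < b → sumℤ (map (λ F → hasRooks k F *ℤ weightOn m R y (just r ∷ F)) X)
                           ≡ (+ 1 -ℤ + (y r * m)) *ℤ rookRec m k (suc s) h
  rook-in-row r r<b = begin
    sumℤ (map (λ F → hasRooks k F *ℤ weightOn m R y (just r ∷ F)) X)
      ≡⟨ cong sumℤ (LP.map-cong (λ F → trans (cong (hasRooks k F *ℤ_) (weightOn-just m R y r F (NP.<-≤-trans r<b b≤R)))
                                            (swap (hasRooks k F) (+ 1 -ℤ + (y r * m)) (weightOn m R (addRook y r) F))) X) ⟩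
    sumℤ (map (λ F → (+ 1 -ℤ + (y r * m)) *ℤ (hasRooks k F *ℤ weightOn m R (addRook y r) F)) X)
      ≡⟨ sumℤ-*ˡ (+ 1 -ℤ + (y r * m)) (λ F → hasRooks k F *ℤ weightOn m R (addRook y r) F) X ⟩
    (+ 1 -ℤ + (y r * m)) *ℤ rookSum m R (addRook y r) k h
      ≡⟨ cong ((+ 1 -ℤ + (y r * m)) *ℤ_) (rookSum≡rookRec m R h b (addRook y r) (suc s) k lk h≤R y′-low y′-sum) ⟩
    (+ 1 -ℤ + (y r * m)) *ℤ rookRec m k (suc s) h ∎
    where
    swap : ∀ a c w → a *ℤ (c *ℤ w) ≡ c *ℤ (a *ℤ w)
    swap = solve-∀
    y′-low : ∀ i → b ≤ i → addRook y r i ≡ 0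
    y′-low i b≤i = cong₂ _+_ (δ-≢ (NP.<⇒≢ (NP.<-≤-trans r<b b≤i))) (y-low i (NP.≤-trans c≤b b≤i))
    y′-sum : Σℕ (addRook y r) b ≡ suc s
    y′-sum = trans (Σℕ-addRook y r b r<b) (cong suc y-sum-b)

f≡rookRec : ∀ k m h → Linked _≤_ h → f k m h ≡ rookRec m k 0 h
f≡rookRec k m h lk =
  trans (f≡rookSum k m h) (rookSum≡rookRec m (cells h) h 0 (λ _ → 0) 0 k (0≤ h lk) (elem≤sum h) (λ _ _ → refl) refl)
  where
  0≤ : ∀ h → Linked _≤_ h → Linked _≤_ (0 ∷ h)
  0≤ []      _ = [-]
  0≤ (x ∷ h) l = z≤n ∷ l
  elem≤sum : ∀ h → All (_≤ sum h) h
  elem≤sum []      = []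
  elem≤sum (b ∷ h) = NP.m≤m+n b (sum h) ∷ All.map (λ x≤ → NP.≤-trans x≤ (NP.m≤n+m (sum h) b)) (elem≤sum h)

-- Coefficient sequences.  A sequence A "of degree n" stands for the
-- polynomial  Σ_{k ≤ n} A k · x↓_{n-k,m}  in the falling-factorial basis;
-- all coefficients beyond n vanish.
Coeffs : Set
Coeffs = ℕ → ℤ

Degree≤ : ℕ → Coeffs → Set
Degree≤ n A = ∀ k → n < k → A k ≡ + 0

fall : ℕ → ℤ → ℕ → ℤ
fall m x zero    = + 1
fall m x (suc l) = fall m x l *ℤ (x -ℤ + (l * m))

eval : ℕ → ℕ → Coeffs → ℤ → ℤ
eval m n A x = Σℤ (λ k → A k *ℤ fall m x (n ∸ k)) (suc n)

shift : Coeffs → Coeffs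
shift A zero    = + 0
shift A (suc k) = A k

-- (n + 1 - k) m: the constant j m in x · x↓_j = x↓_{j+1} + j m x↓_j for j = n + 1 - k
gap : ℕ → ℕ → ℕ → ℤ
gap m n k = + (suc n * m) -ℤ + (k * m)

mulRoot : ℕ → ℕ → ℕ → Coeffs → Coeffs
mulRoot m n v A k = A k +ℤ (gap m n k -ℤ + v) *ℤ shift A k

mulRoots : ℕ → ℕ → Coeffs → List ℕ → Coeffs
mulRoots m n A []       = A
mulRoots m n A (v ∷ vs) = mulRoots m (suc n) (mulRoot m n v A) vs

one : Coeffs
one zero    = + 1
one (suc k) = + 0

rootCoeffs : ℕ → List ℕ → Coeffs
rootCoeffs m vs = mulRoots m 0 one vs

rootProduct : ℤ → List ℕ → ℤ
rootProduct x []       = + 1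
rootProduct x (v ∷ vs) = (x -ℤ + v) *ℤ rootProduct x vs

gap-suc : ∀ m n k → gap m (suc n) (suc k) ≡ gap m n k
gap-suc m n k = begin
  + (suc (suc n) * m) -ℤ + (suc k * m)         ≡⟨ cong₂ _-ℤ_ (ZP.pos-+ m (suc n * m)) (ZP.pos-+ m (k * m)) ⟩
  (+ m +ℤ + (suc n * m)) -ℤ (+ m +ℤ + (k * m)) ≡⟨ cancel (+ m) (+ (suc n * m)) (+ (k * m)) ⟩
  + (suc n * m) -ℤ + (k * m)                   ∎
  where open ≡-Reasoning
        cancel : ∀ a b c → (a +ℤ b) -ℤ (a +ℤ c) ≡ b -ℤ c
        cancel = solve-∀

mulRoot-cong : ∀ m n v {A B} → A ≗ B → mulRoot m n v A ≗ mulRoot m n v B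
mulRoot-cong m n v A≗B zero    = cong (_+ℤ (gap m n 0 -ℤ + v) *ℤ + 0) (A≗B 0)
mulRoot-cong m n v A≗B (suc k) = cong₂ (λ a b → a +ℤ (gap m n (suc k) -ℤ + v) *ℤ b) (A≗B (suc k)) (A≗B k)

mulRoots-cong : ∀ m n vs {A B} → A ≗ B → mulRoots m n A vs ≗ mulRoots m n B vs
mulRoots-cong m n []       A≗B = A≗B
mulRoots-cong m n (v ∷ vs) A≗B = mulRoots-cong m (suc n) vs (mulRoot-cong m n v A≗B)

mulRoot-comm : ∀ m n u v A → mulRoot m (suc n) u (mulRoot m n v A) ≗ mulRoot m (suc n) v (mulRoot m n u A)
mulRoot-comm m n u v A zero = identity (A 0) (gap m n 0 -ℤ + v) (gap m (suc n) 0 -ℤ + u) (gap m n 0 -ℤ + u) (gap m (suc n) 0 -ℤ + v)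
  where identity : ∀ a p q p′ q′ → (a +ℤ p *ℤ + 0) +ℤ q *ℤ + 0 ≡ (a +ℤ p′ *ℤ + 0) +ℤ q′ *ℤ + 0
        identity = solve-∀
mulRoot-comm m n u v A (suc zero) rewrite gap-suc m n 0 =
  identity (A 1) (A 0) (gap m n 1) (gap m n 0) (+ u) (+ v)
  where identity : ∀ A1 A0 g1 g0 u v → (A1 +ℤ (g1 -ℤ v) *ℤ A0) +ℤ (g0 -ℤ u) *ℤ (A0 +ℤ (g0 -ℤ v) *ℤ + 0)
                                     ≡ (A1 +ℤ (g1 -ℤ u) *ℤ A0) +ℤ (g0 -ℤ v) *ℤ (A0 +ℤ (g0 -ℤ u) *ℤ + 0)
        identity = solve-∀
mulRoot-comm m n u v A (suc (suc k)) rewrite gap-suc m n (suc k) =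
  identity (A (suc (suc k))) (A (suc k)) (A k) (gap m n (suc (suc k))) (gap m n (suc k)) (+ u) (+ v)
  where identity : ∀ A2 A1 A0 g2 g1 u v → (A2 +ℤ (g2 -ℤ v) *ℤ A1) +ℤ (g1 -ℤ u) *ℤ (A1 +ℤ (g1 -ℤ v) *ℤ A0)
                                        ≡ (A2 +ℤ (g2 -ℤ u) *ℤ A1) +ℤ (g1 -ℤ v) *ℤ (A1 +ℤ (g1 -ℤ u) *ℤ A0)
        identity = solve-∀

mulRoots-↭ : ∀ m {xs ys} → xs ↭ ys → ∀ n A → mulRoots m n A xs ≗ mulRoots m n A ys
mulRoots-↭ m Perm.refl          n A k = refl
mulRoots-↭ m (Perm.prep x p)    n A   = mulRoots-↭ m p (suc n) (mulRoot m n x A)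
mulRoots-↭ m (Perm.swap {xs} x y p) n A k =
  trans (mulRoots-cong m (suc (suc n)) xs (mulRoot-comm m n y x A) k)
        (mulRoots-↭ m p (suc (suc n)) (mulRoot m (suc n) x (mulRoot m n y A)) k)
mulRoots-↭ m (Perm.trans p q)   n A k = trans (mulRoots-↭ m p n A k) (mulRoots-↭ m q n A k)

mulRoots-∷ʳ : ∀ m n A xs v → mulRoots m n A (xs ∷ʳ v) ≡ mulRoot m (n + length xs) v (mulRoots m n A xs)
mulRoots-∷ʳ m n A []       v = cong (λ z → mulRoot m z v A) (sym (NP.+-identityʳ n))
mulRoots-∷ʳ m n A (x ∷ xs) v = trans (mulRoots-∷ʳ m (suc n) (mulRoot m n x A) xs v)
  (cong (λ z → mulRoot m z v (mulRoots m (suc n) (mulRoot m n x A) xs)) (sym (NP.+-suc n (length xs))))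

rootCoeffs-∷ : ∀ m v a → rootCoeffs m (v ∷ a) ≗ mulRoot m (length a) v (rootCoeffs m a)
rootCoeffs-∷ m v a k = trans (mulRoots-↭ m (PermP.∷↭∷ʳ v a) 0 one k) (cong (λ P → P k) (mulRoots-∷ʳ m 0 one a v))

mulRoot-cancel : ∀ m n v A B → mulRoot m n v A ≗ mulRoot m n v B → A ≗ B
mulRoot-cancel m n v A B e zero = begin
  A 0                                  ≡⟨ sym (no-shift (A 0)) ⟩
  A 0 +ℤ (gap m n 0 -ℤ + v) *ℤ + 0     ≡⟨ e 0 ⟩
  B 0 +ℤ (gap m n 0 -ℤ + v) *ℤ + 0     ≡⟨ no-shift (B 0) ⟩
  B 0                                  ∎
  where open ≡-Reasoning
        no-shift : ∀ a → a +ℤ (gap m n 0 -ℤ + v) *ℤ + 0 ≡ a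
        no-shift a = trans (cong (a +ℤ_) (ZP.*-zeroʳ (gap m n 0 -ℤ + v))) (ZP.+-identityʳ a)
mulRoot-cancel m n v A B e (suc k) = +-cancelʳ (c *ℤ B k) (A (suc k)) (B (suc k))
  (trans (cong (λ z → A (suc k) +ℤ c *ℤ z) (sym (mulRoot-cancel m n v A B e k))) (e (suc k)))
  where c = gap m n (suc k) -ℤ + v

degree-mulRoot : ∀ m n v A → Degree≤ n A → Degree≤ (suc n) (mulRoot m n v A)
degree-mulRoot m n v A deg (suc k) (s≤s n<k) =
  trans (cong₂ (λ a b → a +ℤ (gap m n (suc k) -ℤ + v) *ℤ b) (deg (suc k) (NP.m<n⇒m<1+n n<k)) (deg k n<k))
        (trans (ZP.+-identityˡ _) (ZP.*-zeroʳ (gap m n (suc k) -ℤ + v)))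

degree-mulRoots : ∀ m n A vs → Degree≤ n A → Degree≤ (n + length vs) (mulRoots m n A vs)
degree-mulRoots m n A []       deg = subst (λ d → Degree≤ d A) (sym (NP.+-identityʳ n)) deg
degree-mulRoots m n A (v ∷ vs) deg = subst (λ d → Degree≤ d (mulRoots m (suc n) (mulRoot m n v A) vs))
  (sym (NP.+-suc n (length vs))) (degree-mulRoots m (suc n) (mulRoot m n v A) vs (degree-mulRoot m n v A deg))

degree-one : Degree≤ 0 one
degree-one (suc k) _ = refl

gap-sub : ∀ m n j → j ≤ n → gap m n (suc j) ≡ + ((n ∸ j) * m)
gap-sub m n j j≤n = begin
  + (suc n * m) -ℤ + (suc j * m)                     ≡⟨ cong (λ z → + (z * m) -ℤ + (suc j * m)) (sym split) ⟩
  + (((n ∸ j) + suc j) * m) -ℤ + (suc j * m)         ≡⟨ cong (λ z → + z -ℤ + (suc j * m)) (NP.*-distribʳ-+ m (n ∸ j) (suc j)) ⟩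
  + ((n ∸ j) * m + suc j * m) -ℤ + (suc j * m)       ≡⟨ cong (_-ℤ + (suc j * m)) (ZP.pos-+ ((n ∸ j) * m) (suc j * m)) ⟩
  (+ ((n ∸ j) * m) +ℤ + (suc j * m)) -ℤ + (suc j * m) ≡⟨ cancel (+ ((n ∸ j) * m)) (+ (suc j * m)) ⟩
  + ((n ∸ j) * m)                                     ∎
  where open ≡-Reasoning
        split : (n ∸ j) + suc j ≡ suc n
        split = trans (NP.+-suc (n ∸ j) j) (cong suc (NP.m∸n+n≡m j≤n))
        cancel : ∀ x y → (x +ℤ y) -ℤ y ≡ x
        cancel = solve-∀

-- The basis identity behind mulRoot, termwise: as gap m n (1+k) = (n-k) m,
-- (x - v) x↓_{n-k} = x↓_{n+1-k} + (gap m n (1+k) - v) x↓_{n-k}.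
mulRoot-term : ∀ m n v (A : Coeffs) x k → k ≤ n →
  A k *ℤ fall m x (suc n ∸ k) +ℤ ((gap m n (suc k) -ℤ + v) *ℤ A k) *ℤ fall m x (n ∸ k)
    ≡ (A k *ℤ fall m x (n ∸ k)) *ℤ (x -ℤ + v)
mulRoot-term m n v A x k k≤n rewrite NP.+-∸-assoc 1 k≤n | gap-sub m n k k≤n =
  identity (A k) (fall m x (n ∸ k)) x (+ ((n ∸ k) * m)) (+ v)
  where identity : ∀ a f x g v → a *ℤ (f *ℤ (x -ℤ g)) +ℤ ((g -ℤ v) *ℤ a) *ℤ f ≡ (a *ℤ f) *ℤ (x -ℤ v)
        identity = solve-∀

eval-mulRoot : ∀ m n v A x → Degree≤ n A → eval m (suc n) (mulRoot m n v A) x ≡ eval m n A x *ℤ (x -ℤ + v)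
eval-mulRoot m n v A x deg = begin
  Σℤ (λ k → mulRoot m n v A k *ℤ F k) (2 + n)
    ≡⟨ Σℤ-cong (2 + n) (λ k _ → ZP.*-distribʳ-+ (F k) (A k) _) ⟩
  Σℤ (λ k → A k *ℤ F k +ℤ G k) (2 + n)
    ≡⟨ Σℤ-+ (λ k → A k *ℤ F k) G (2 + n) ⟩
  Σℤ (λ k → A k *ℤ F k) (2 + n) +ℤ Σℤ G (2 + n)
    ≡⟨ cong₂ _+ℤ_ top-vanishes first-vanishes ⟩
  Σℤ (λ k → A k *ℤ F k) (suc n) +ℤ Σℤ (λ k → G (suc k)) (suc n)
    ≡⟨ sym (Σℤ-+ (λ k → A k *ℤ F k) (λ k → G (suc k)) (suc n)) ⟩
  Σℤ (λ k → A k *ℤ F k +ℤ G (suc k)) (suc n)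
    ≡⟨ Σℤ-cong (suc n) (λ k k<1+n → mulRoot-term m n v A x k (NP.≤-pred k<1+n)) ⟩
  Σℤ (λ k → (A k *ℤ fall m x (n ∸ k)) *ℤ (x -ℤ + v)) (suc n)
    ≡⟨ Σℤ-*ʳ (λ k → A k *ℤ fall m x (n ∸ k)) (x -ℤ + v) (suc n) ⟩
  eval m n A x *ℤ (x -ℤ + v) ∎
  where
  open ≡-Reasoning
  F : ℕ → ℤ
  F k = fall m x (suc n ∸ k)
  G : ℕ → ℤ
  G k = ((gap m n k -ℤ + v) *ℤ shift A k) *ℤ F k
  top-vanishes : Σℤ (λ k → A k *ℤ F k) (2 + n) ≡ Σℤ (λ k → A k *ℤ F k) (suc n)
  top-vanishes = trans (cong (λ a → Σℤ (λ k → A k *ℤ F k) (suc n) +ℤ a *ℤ F (suc n)) (deg (suc n) NP.≤-refl))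
                       (trans (cong (Σℤ (λ k → A k *ℤ F k) (suc n) +ℤ_) (ZP.*-zeroˡ (F (suc n)))) (ZP.+-identityʳ _))
  first-vanishes : Σℤ G (2 + n) ≡ Σℤ (λ k → G (suc k)) (suc n)
  first-vanishes = trans (Σℤ-suc G (suc n))
    (trans (cong (_+ℤ Σℤ (λ k → G (suc k)) (suc n))
                 (trans (cong (_*ℤ F 0) (ZP.*-zeroʳ (gap m n 0 -ℤ + v))) (ZP.*-zeroˡ (F 0))))
           (ZP.+-identityˡ _))

eval-mulRoots : ∀ m n A vs x → Degree≤ n A →
  eval m (n + length vs) (mulRoots m n A vs) x ≡ eval m n A x *ℤ rootProduct x vs
eval-mulRoots m n A []       x deg = trans (cong (λ d → eval m d A x) (NP.+-identityʳ n)) (sym (ZP.*-identityʳ _))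
eval-mulRoots m n A (v ∷ vs) x deg = begin
  eval m (n + suc (length vs)) (mulRoots m (suc n) (mulRoot m n v A) vs) x
    ≡⟨ cong (λ d → eval m d (mulRoots m (suc n) (mulRoot m n v A) vs) x) (NP.+-suc n (length vs)) ⟩
  eval m (suc n + length vs) (mulRoots m (suc n) (mulRoot m n v A) vs) x
    ≡⟨ eval-mulRoots m (suc n) (mulRoot m n v A) vs x (degree-mulRoot m n v A deg) ⟩
  eval m (suc n) (mulRoot m n v A) x *ℤ rootProduct x vs
    ≡⟨ cong (_*ℤ rootProduct x vs) (eval-mulRoot m n v A x deg) ⟩
  (eval m n A x *ℤ (x -ℤ + v)) *ℤ rootProduct x vs
    ≡⟨ ZP.*-assoc (eval m n A x) _ _ ⟩
  eval m n A x *ℤ rootProduct x (v ∷ vs) ∎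
  where open ≡-Reasoning

eval-rootCoeffs : ∀ m vs x → eval m (length vs) (rootCoeffs m vs) x ≡ rootProduct x vs
eval-rootCoeffs m vs x = trans (eval-mulRoots m 0 one vs x degree-one) (ZP.*-identityˡ _)

eval-cong : ∀ m n {A B} x → A ≗ B → eval m n A x ≡ eval m n B x
eval-cong m n x A≗B = Σℤ-cong (suc n) (λ k _ → cong (_*ℤ fall m x (n ∸ k)) (A≗B k))

rootProduct-root : ∀ v vs → rootProduct (+ v) vs ≡ + 0 → v ∈ vs
rootProduct-root v (w ∷ vs) e with ZP.i*j≡0⇒i≡0∨j≡0 (+ v -ℤ + w) e
... | inj₁ v-w≡0 = here (ZP.+-injective (ZP.i-j≡0⇒i≡j (+ v) (+ w) v-w≡0))
... | inj₂ rest  = there (rootProduct-root v vs rest)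

∈⇒↭∷ : ∀ {A : Set} {x : A} {xs} → x ∈ xs → Σ (List A) (λ ys → xs ↭ x ∷ ys)
∈⇒↭∷ {x = x} x∈xs with MP.∈-∃++ x∈xs
... | ys , zs , refl = ys ++ zs , PermP.shift x ys zs

rootCoeffs-injective : ∀ m a b → length a ≡ length b → rootCoeffs m a ≗ rootCoeffs m b → a ↭ b
rootCoeffs-injective m []      []      _   _ = Perm.refl
rootCoeffs-injective m []      (w ∷ b) ()  _
rootCoeffs-injective m (v ∷ a) b       len e with ∈⇒↭∷ v∈b
  where
  v∈b : v ∈ b
  v∈b = rootProduct-root v b (begin
    rootProduct (+ v) b                                       ≡⟨ sym (eval-rootCoeffs m b (+ v)) ⟩
    eval m (length b) (rootCoeffs m b) (+ v)                  ≡⟨ cong (λ d → eval m d (rootCoeffs m b) (+ v)) (sym len) ⟩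
    eval m (suc (length a)) (rootCoeffs m b) (+ v)            ≡⟨ eval-cong m (suc (length a)) (+ v) (λ k → sym (e k)) ⟩
    eval m (suc (length a)) (rootCoeffs m (v ∷ a)) (+ v)      ≡⟨ eval-cong m (suc (length a)) (+ v) (rootCoeffs-∷ m v a) ⟩
    eval m (suc (length a)) (mulRoot m (length a) v (rootCoeffs m a)) (+ v)
      ≡⟨ eval-mulRoot m (length a) v (rootCoeffs m a) (+ v) (degree-mulRoots m 0 one a degree-one) ⟩
    eval m (length a) (rootCoeffs m a) (+ v) *ℤ (+ v -ℤ + v)  ≡⟨ cong (eval m (length a) (rootCoeffs m a) (+ v) *ℤ_) (ZP.+-inverseʳ (+ v)) ⟩
    eval m (length a) (rootCoeffs m a) (+ v) *ℤ + 0            ≡⟨ ZP.*-zeroʳ (eval m (length a) (rootCoeffs m a) (+ v)) ⟩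
    + 0                                                        ∎)
    where open ≡-Reasoning
... | b′ , b↭vb′ = ↭-trans (Perm.prep v (rootCoeffs-injective m a b′ len′ (mulRoot-cancel m (length a) v _ _ e′))) (↭-sym b↭vb′)
  where
  len′ : length a ≡ length b′
  len′ = NP.suc-injective (trans len (PermP.↭-length b↭vb′))
  e′ : mulRoot m (length a) v (rootCoeffs m a) ≗ mulRoot m (length a) v (rootCoeffs m b′)
  e′ k = begin
    mulRoot m (length a) v (rootCoeffs m a) k  ≡⟨ sym (rootCoeffs-∷ m v a k) ⟩
    rootCoeffs m (v ∷ a) k                     ≡⟨ e k ⟩
    rootCoeffs m b k                           ≡⟨ mulRoots-↭ m b↭vb′ 0 one k ⟩
    rootCoeffs m (v ∷ b′) k                    ≡⟨ rootCoeffs-∷ m v b′ k ⟩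
    mulRoot m (length b′) v (rootCoeffs m b′) k ≡⟨ cong (λ d → mulRoot m d v (rootCoeffs m b′) k) (sym len′) ⟩
    mulRoot m (length a) v (rootCoeffs m b′) k ∎
    where open ≡-Reasoning

-- Adding a last column c to the board: the new rook either sits in it or not.
rookRec-∷ʳ : ∀ m p c s k → rookRec m (suc k) s (p ∷ʳ c) ≡ rookRec m (suc k) s p +ℤ (+ c -ℤ + ((s + k) * m)) *ℤ rookRec m k s p
rookRec-∷ʳ m []      c s zero    rewrite NP.+-identityʳ s = refl
rookRec-∷ʳ m []      c s (suc k) = trans (ZP.+-identityˡ _) (trans (ZP.*-zeroʳ (+ c -ℤ + (s * m)))
  (sym (trans (ZP.+-identityˡ _) (ZP.*-zeroʳ (+ c -ℤ + ((s + suc k) * m))))))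
rookRec-∷ʳ m (b ∷ p) c s zero    rewrite rookRec-∷ʳ m p c s zero =
  identity (rookRec m 1 s p) (+ c -ℤ + ((s + 0) * m)) (+ b -ℤ + (s * m))
  where identity : ∀ X C B → (X +ℤ C *ℤ + 1) +ℤ B *ℤ + 1 ≡ (X +ℤ B *ℤ + 1) +ℤ C *ℤ + 1
        identity = solve-∀
rookRec-∷ʳ m (b ∷ p) c s (suc k) rewrite rookRec-∷ʳ m p c s (suc k) | rookRec-∷ʳ m p c (suc s) k | NP.+-suc s k =
  identity (rookRec m (2 + k) s p) (rookRec m (suc k) s p) (rookRec m (suc k) (suc s) p) (rookRec m k (suc s) p)
           (+ b -ℤ + (s * m)) (+ c -ℤ + (suc (s + k) * m))
  where identity : ∀ X Y Z W B C → (X +ℤ C *ℤ Y) +ℤ B *ℤ (Z +ℤ C *ℤ W) ≡ (X +ℤ B *ℤ Z) +ℤ C *ℤ (Y +ℤ B *ℤ W)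
        identity = solve-∀

omegaFrom : ℕ → ℕ → List ℕ → List ℕ
omegaFrom m j []      = []
omegaFrom m j (b ∷ p) = (j * m ∸ b) ∷ omegaFrom m (suc j) p

omegaFrom-∷ʳ : ∀ m j p c → omegaFrom m j (p ∷ʳ c) ≡ omegaFrom m j p ∷ʳ ((j + length p) * m ∸ c)
omegaFrom-∷ʳ m j []      c rewrite NP.+-identityʳ j = refl
omegaFrom-∷ʳ m j (b ∷ p) c rewrite omegaFrom-∷ʳ m (suc j) p c | NP.+-suc j (length p) = refl

length-omegaFrom : ∀ m j p → length (omegaFrom m j p) ≡ length p
length-omegaFrom m j []      = refl
length-omegaFrom m j (b ∷ p) = cong suc (length-omegaFrom m (suc j) p)

-- Every column lies under the line of slope m: b_i ≤ (j+i) m, so that the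
-- truncated subtractions in omegaFrom are exact.
UnderLine : ℕ → ℕ → List ℕ → Set
UnderLine m j []      = ⊤
UnderLine m j (b ∷ p) = b ≤ j * m × UnderLine m (suc j) p

underLine-∷ʳ : ∀ m j p c → UnderLine m j (p ∷ʳ c) → UnderLine m j p × c ≤ (j + length p) * m
underLine-∷ʳ m j []      c (c≤ , _) rewrite NP.+-identityʳ j = tt , c≤
underLine-∷ʳ m j (b ∷ p) c (b≤ , ul) with underLine-∷ʳ m (suc j) p c ul
... | ul′ , c≤ rewrite NP.+-suc j (length p) = (b≤ , ul′) , c≤

last-column-factor : ∀ m n k c → c ≤ n * m → + c -ℤ + (k * m) ≡ gap m n (suc k) -ℤ + (n * m ∸ c)
last-column-factor m n k c c≤ = begin
  + c -ℤ + (k * m)                                              ≡⟨ identity (+ c) (+ (k * m)) (+ m) (+ (n * m)) ⟩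
  (+ m +ℤ + (n * m)) -ℤ (+ m +ℤ + (k * m)) -ℤ (+ (n * m) -ℤ + c) ≡⟨ cong₂ (λ u w → u -ℤ w -ℤ (+ (n * m) -ℤ + c)) (sym (ZP.pos-+ m (n * m))) (sym (ZP.pos-+ m (k * m))) ⟩
  gap m n (suc k) -ℤ (+ (n * m) -ℤ + c)                          ≡⟨ cong (gap m n (suc k) -ℤ_) (trans (ZP.[+m]-[+n]≡m⊖n (n * m) c) (ZP.⊖-≥ c≤)) ⟩
  gap m n (suc k) -ℤ + (n * m ∸ c)                               ∎
  where open ≡-Reasoning
        identity : ∀ c km mm nm → c -ℤ km ≡ (mm +ℤ nm) -ℤ (mm +ℤ km) -ℤ (nm -ℤ c)
        identity = solve-∀

rookRec≡rootCoeffs : ∀ m p → UnderLine m 0 p → ∀ k → rookRec m k 0 p ≡ rootCoeffs m (omegaFrom m 0 p) k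
rookRec≡rootCoeffs m p = go p (reverseView p)
  where
  go : ∀ p → Reverse p → UnderLine m 0 p → ∀ k → rookRec m k 0 p ≡ rootCoeffs m (omegaFrom m 0 p) k
  go .[] [] _ zero    = refl
  go .[] [] _ (suc k) = refl
  go .(p ∷ʳ c) (p ∶ r ∶ʳ c) ul k
    rewrite omegaFrom-∷ʳ m 0 p c | mulRoots-∷ʳ m 0 one (omegaFrom m 0 p) (length p * m ∸ c) | length-omegaFrom m 0 p
    = step k
    where
    n = length p
    A = rootCoeffs m (omegaFrom m 0 p)
    ih : ∀ k → rookRec m k 0 p ≡ A k
    ih = go p r (proj₁ (underLine-∷ʳ m 0 p c ul))
    step : ∀ k → rookRec m k 0 (p ∷ʳ c) ≡ mulRoot m n (n * m ∸ c) A k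
    step zero    = sym (trans (cong (A 0 +ℤ_) (ZP.*-zeroʳ (gap m n 0 -ℤ + (n * m ∸ c)))) (trans (ZP.+-identityʳ (A 0)) (sym (ih 0))))
    step (suc k) = begin
      rookRec m (suc k) 0 (p ∷ʳ c)                                  ≡⟨ rookRec-∷ʳ m p c 0 k ⟩
      rookRec m (suc k) 0 p +ℤ (+ c -ℤ + (k * m)) *ℤ rookRec m k 0 p ≡⟨ cong₂ (λ u w → u +ℤ (+ c -ℤ + (k * m)) *ℤ w) (ih (suc k)) (ih k) ⟩
      A (suc k) +ℤ (+ c -ℤ + (k * m)) *ℤ A k                         ≡⟨ cong (λ z → A (suc k) +ℤ z *ℤ A k) (last-column-factor m n k c (proj₂ (underLine-∷ʳ m 0 p c ul))) ⟩
      A (suc k) +ℤ (gap m n (suc k) -ℤ + (n * m ∸ c)) *ℤ A k         ∎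
      where open ≡-Reasoning

rookRec-zeros : ∀ m k z h → rookRec m k 0 (replicate z 0 ++ h) ≡ rookRec m k 0 h
rookRec-zeros m k       zero    h = refl
rookRec-zeros m zero    (suc z) h = refl
rookRec-zeros m (suc k) (suc z) h =
  trans (cong (rookRec m (suc k) 0 (replicate z 0 ++ h) +ℤ_) (ZP.*-zeroˡ (rookRec m k 1 (replicate z 0 ++ h))))
        (trans (ZP.+-identityʳ _) (rookRec-zeros m (suc k) z h))

padding : List ℕ → ℕ
padding h = suc (cells h) ∸ length h

-- A board with nonzero columns has at most |B| columns, so padding is exact.
nonzero-length≤cells : ∀ h → All (0 <_) h → length h ≤ cells h
nonzero-length≤cells []      []           = z≤n
nonzero-length≤cells (b ∷ h) (0<b ∷ h>0) = NP.+-mono-≤ 0<b (nonzero-length≤cells h h>0)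

length-padded : ∀ h → IsFerrers h → length (padded h) ≡ suc (cells h)
length-padded h (_ , h>0) = trans (LP.length-++ (replicate (padding h) 0))
  (trans (cong (_+ length h) (LP.length-replicate (padding h)))
         (NP.m∸n+n≡m (NP.m≤n⇒m≤1+n (nonzero-length≤cells h h>0))))

omega≡omegaFrom : ∀ m h → IsFerrers h → omega m h ≡ omegaFrom m 0 (padded h)
omega≡omegaFrom m h ferrers =
  trans (cong (λ n → zipWith (λ j bj → j * m ∸ bj) (upTo n) (padded h)) (sym (length-padded h ferrers)))
        (zip-omega 0 id (padded h) (λ i → refl))
  where
  zip-omega : ∀ j (g : ℕ → ℕ) p → (∀ i → g i ≡ j + i) →
    zipWith (λ i b → i * m ∸ b) (applyUpTo g (length p)) p ≡ omegaFrom m j p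
  zip-omega j g []      e = refl
  zip-omega j g (b ∷ p) e = cong₂ _∷_ (cong (λ i → i * m ∸ b) (trans (e 0) (NP.+-identityʳ j)))
    (zip-omega (suc j) (g ∘ suc) p (λ i → trans (e (suc i)) (NP.+-suc j i)))

length-omega : ∀ m h → IsFerrers h → length (omega m h) ≡ suc (cells h)
length-omega m h ferrers = trans (cong length (omega≡omegaFrom m h ferrers))
  (trans (length-omegaFrom m 0 (padded h)) (length-padded h ferrers))

length*≤sum : ∀ b h → All (b ≤_) h → length h * b ≤ sum h
length*≤sum b []      []          = z≤n
length*≤sum b (x ∷ h) (b≤x ∷ b≤h) = NP.+-mono-≤ b≤x (length*≤sum b h b≤h)

-- If a nondecreasing list is short of sum, its first entry is small:
-- sum (b ∷ h) < j + ℓ with ℓ = length (b ∷ h) forces b ≤ j, since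
-- b > j would give sum ≥ ℓ b ≥ ℓ (1 + j) ≥ ℓ + j.
head≤ : ∀ j b h → Linked _≤_ (b ∷ h) → sum (b ∷ h) < j + length (b ∷ h) → b ≤ j
head≤ j b h sorted small = NP.≮⇒≥ λ j<b → NP.<-irrefl refl (begin-strict
  sum (b ∷ h)         <⟨ small ⟩
  j + ℓ               ≡⟨ NP.+-comm j ℓ ⟩
  ℓ + j               ≤⟨ NP.+-monoʳ-≤ ℓ (NP.m≤n*m j ℓ) ⟩
  ℓ + ℓ * j           ≡⟨ sym (NP.*-suc ℓ j) ⟩
  ℓ * suc j           ≤⟨ NP.*-monoʳ-≤ ℓ j<b ⟩
  ℓ * b               ≤⟨ length*≤sum b (b ∷ h) (LinkedP.Linked⇒All NP.≤-trans NP.≤-refl sorted) ⟩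
  sum (b ∷ h)         ∎)
  where open NP.≤-Reasoning
        ℓ = length (b ∷ h)

underLine-short : ∀ m j h → 1 ≤ m → Linked _≤_ h → sum h < j + length h → UnderLine m j h
underLine-short m j []      1≤m _      _     = tt
underLine-short m j (b ∷ h) 1≤m sorted small =
  NP.≤-trans (head≤ j b h sorted small) (NP.m≤m*n j m {{ℕ.>-nonZero 1≤m}}) ,
  underLine-short m (suc j) h 1≤m (Linked.tail sorted)
    (NP.≤-trans (s≤s (NP.m≤n+m (sum h) b)) (NP.≤-trans small (NP.≤-reflexive (NP.+-suc j (length h)))))

underLine-zeros : ∀ m j z h → UnderLine m (j + z) h → UnderLine m j (replicate z 0 ++ h)
underLine-zeros m j zero    h ul = subst (λ w → UnderLine m w h) (NP.+-identityʳ j) ul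
underLine-zeros m j (suc z) h ul = z≤n , underLine-zeros m (suc j) z h (subst (λ w → UnderLine m w h) (NP.+-suc j z) ul)

underLine-padded : ∀ m h → 1 ≤ m → IsFerrers h → UnderLine m 0 (padded h)
underLine-padded m h 1≤m (sorted , h>0) =
  underLine-zeros m 0 (padding h) h (underLine-short m (padding h) h 1≤m sorted short)
  where short : sum h < padding h + length h
        short = NP.≤-reflexive (sym (NP.m∸n+n≡m (NP.m≤n⇒m≤1+n (nonzero-length≤cells h h>0))))

f≡rootCoeffs-omega : ∀ m h → 1 ≤ m → IsFerrers h → ∀ k → f k m h ≡ rootCoeffs m (omega m h) k
f≡rootCoeffs-omega m h 1≤m ferrers k = begin
  f k m h                                 ≡⟨ f≡rookRec k m h (proj₁ ferrers) ⟩
  rookRec m k 0 h                         ≡⟨ sym (rookRec-zeros m k (padding h) h) ⟩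
  rookRec m k 0 (padded h)                ≡⟨ rookRec≡rootCoeffs m (padded h) (underLine-padded m h 1≤m ferrers) k ⟩
  rootCoeffs m (omegaFrom m 0 (padded h)) k ≡⟨ cong (λ ν → rootCoeffs m ν k) (sym (omega≡omegaFrom m h ferrers)) ⟩
  rootCoeffs m (omega m h) k              ∎
  where open ≡-Reasoning

rookRec-one : ∀ m h → rookRec m 1 0 h ≡ + sum h
rookRec-one m []      = refl
rookRec-one m (b ∷ h) = begin
  rookRec m 1 0 h +ℤ (+ b -ℤ + 0) *ℤ + 1 ≡⟨ cong₂ _+ℤ_ (rookRec-one m h) (trans (ZP.*-identityʳ _) (ZP.+-identityʳ (+ b))) ⟩
  + sum h +ℤ + b                         ≡⟨ sym (ZP.pos-+ (sum h) b) ⟩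
  + (sum h + b)                          ≡⟨ cong +_ (NP.+-comm (sum h) b) ⟩
  + (b + sum h)                          ∎
  where open ≡-Reasoning

equiv⇒omega-↭ : ∀ m h h′ → 1 ≤ m → IsFerrers h → IsFerrers h′ → FileEquiv m h h′ → omega m h ↭ omega m h′
equiv⇒omega-↭ m h h′ 1≤m ferrers ferrers′ equiv =
  rootCoeffs-injective m (omega m h) (omega m h′) same-length
    (λ k → trans (sym (f≡rootCoeffs-omega m h 1≤m ferrers k)) (trans (equiv k) (f≡rootCoeffs-omega m h′ 1≤m ferrers′ k)))
  where
  same-cells : cells h ≡ cells h′
  same-cells = ZP.+-injective (begin
    + cells h       ≡⟨ sym (rookRec-one m h) ⟩
    rookRec m 1 0 h ≡⟨ sym (f≡rookRec 1 m h (proj₁ ferrers)) ⟩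
    f 1 m h         ≡⟨ equiv 1 ⟩
    f 1 m h′        ≡⟨ f≡rookRec 1 m h′ (proj₁ ferrers′) ⟩
    rookRec m 1 0 h′ ≡⟨ rookRec-one m h′ ⟩
    + cells h′      ∎)
    where open ≡-Reasoning
  same-length = trans (length-omega m h ferrers) (trans (cong suc same-cells) (sym (length-omega m h′ ferrers′)))

omega-↭⇒equiv : ∀ m h h′ → 1 ≤ m → IsFerrers h → IsFerrers h′ → omega m h ↭ omega m h′ → FileEquiv m h h′
omega-↭⇒equiv m h h′ 1≤m ferrers ferrers′ ω↭ω′ k =
  trans (f≡rootCoeffs-omega m h 1≤m ferrers k) (trans (mulRoots-↭ m ω↭ω′ 0 one k) (sym (f≡rootCoeffs-omega m h′ 1≤m ferrers′ k)))

-- Weak compositions of n supported on a set of slots: a list rs with one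
-- part per slot, parts at closed (false) slots being 0.
data Fits : List Bool → List ℕ → Set where
  []     : Fits [] []
  closed : ∀ {bs rs} → Fits bs rs → Fits (false ∷ bs) (0 ∷ rs)
  free   : ∀ {bs rs} r → Fits bs rs → Fits (true ∷ bs) (r ∷ rs)

openSlots : List Bool → ℕ
openSlots []           = 0
openSlots (true ∷ bs)  = suc (openSlots bs)
openSlots (false ∷ bs) = openSlots bs

bumpHead : List ℕ → List ℕ
bumpHead []       = []
bumpHead (r ∷ rs) = suc r ∷ rs

-- All weak compositions of n fitting the slots bs: a composition of n+1
-- either has first part 0 or arises from one of n by bumping the first part.
compositions : List Bool → ℕ → List (List ℕ)
compositions []           zero    = [] ∷ []
compositions []           (suc n) = []
compositions (false ∷ bs) n       = map (0 ∷_) (compositions bs n)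
compositions (true ∷ bs)  zero    = map (0 ∷_) (compositions bs zero)
compositions (true ∷ bs)  (suc n) = map (0 ∷_) (compositions bs (suc n)) ++ map bumpHead (compositions (true ∷ bs) n)

prepend-zero : ∀ {b bs n v} → (∀ {rs} → Fits bs rs → Fits (b ∷ bs) (0 ∷ rs)) →
  (∀ {rs} → rs ∈ compositions bs n → Fits bs rs × sum rs ≡ n) →
  v ∈ map (0 ∷_) (compositions bs n) → Fits (b ∷ bs) v × sum v ≡ n
prepend-zero fit sound mem with MP.∈-map⁻ (0 ∷_) mem
... | _ , mem′ , refl = Prod.map₁ fit (sound mem′)

bump : ∀ {bs n v} → (∀ {rs} → rs ∈ compositions (true ∷ bs) n → Fits (true ∷ bs) rs × sum rs ≡ n) →
  v ∈ map bumpHead (compositions (true ∷ bs) n) → Fits (true ∷ bs) v × sum v ≡ suc n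
bump sound mem with MP.∈-map⁻ bumpHead mem
bump sound mem | []    , mem′ , refl with sound mem′
bump sound mem | []    , mem′ , refl | () , _
bump sound mem | r ∷ _ , mem′ , refl with sound mem′
bump sound mem | r ∷ _ , mem′ , refl | free .r fits , total = free (suc r) fits , cong suc total

compositions-sound : ∀ bs n {rs} → rs ∈ compositions bs n → Fits bs rs × sum rs ≡ n
compositions-sound []           zero    (here refl) = [] , refl
compositions-sound (false ∷ bs) n       mem = prepend-zero closed (compositions-sound bs n) mem
compositions-sound (true ∷ bs)  zero    mem = prepend-zero (free 0) (compositions-sound bs zero) mem
compositions-sound (true ∷ bs)  (suc n) mem =
  Sum.[ prepend-zero (free 0) (compositions-sound bs (suc n)) , bump (compositions-sound (true ∷ bs) n) ]
      (MP.∈-++⁻ (map (0 ∷_) (compositions bs (suc n))) mem)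

compositions-complete : ∀ bs rs → Fits bs rs → rs ∈ compositions bs (sum rs)
compositions-complete []           []             []           = here refl
compositions-complete (false ∷ bs) (0 ∷ rs)       (closed fits) = MP.∈-map⁺ (0 ∷_) (compositions-complete bs rs fits)
compositions-complete (true ∷ bs)  (zero ∷ rs)    (free 0 fits) with sum rs | compositions-complete bs rs fits
... | zero  | mem = MP.∈-map⁺ (0 ∷_) mem
... | suc n | mem = MP.∈-++⁺ˡ (MP.∈-map⁺ (0 ∷_) mem)
compositions-complete (true ∷ bs)  (suc r ∷ rs)   (free _ fits) =
  MP.∈-++⁺ʳ (map (0 ∷_) (compositions bs (suc (r + sum rs))))
            (MP.∈-map⁺ bumpHead (compositions-complete (true ∷ bs) (r ∷ rs) (free r fits)))

compositions-unique : ∀ bs n → Unique (compositions bs n)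
compositions-unique []           zero    = [] ∷ []
compositions-unique []           (suc n) = []
compositions-unique (false ∷ bs) n       = UP.map⁺ LP.∷-injectiveʳ (compositions-unique bs n)
compositions-unique (true ∷ bs)  zero    = UP.map⁺ LP.∷-injectiveʳ (compositions-unique bs zero)
compositions-unique (true ∷ bs)  (suc n) =
  UP.++⁺ (UP.map⁺ LP.∷-injectiveʳ (compositions-unique bs (suc n))) (UP.map⁺ bumpHead-injective (compositions-unique (true ∷ bs) n)) disjoint
  where
  bumpHead-injective : ∀ {xs ys} → bumpHead xs ≡ bumpHead ys → xs ≡ ys
  bumpHead-injective {[]}    {[]}    refl = refl
  bumpHead-injective {_ ∷ _} {_ ∷ _} refl = refl
  -- a bumped list never starts with 0 (and is never empty here)
  disjoint : ∀ {v} → ¬ (v ∈ map (0 ∷_) (compositions bs (suc n)) × v ∈ map bumpHead (compositions (true ∷ bs) n))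
  disjoint (mem₁ , mem₂) with MP.∈-map⁻ (0 ∷_) mem₁ | MP.∈-map⁻ bumpHead mem₂
  ... | _ , _ , refl | []    , _ , ()
  ... | _ , _ , refl | _ ∷ _ , _ , ()

length-compositions : ∀ bs n → length (compositions bs n) ≡ (openSlots bs + n ∸ 1) C n
length-compositions []           zero    = refl
length-compositions []           (suc n) = sym (k>n⇒nCk≡0 (NP.n<1+n n))
length-compositions (false ∷ bs) n       = trans (LP.length-map (0 ∷_) (compositions bs n)) (length-compositions bs n)
length-compositions (true ∷ bs)  zero    = trans (LP.length-map (0 ∷_) (compositions bs zero)) (length-compositions bs zero)
length-compositions (true ∷ bs)  (suc n) = begin
  length (map (0 ∷_) (compositions bs (suc n)) ++ map bumpHead (compositions (true ∷ bs) n))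
    ≡⟨ LP.length-++ (map (0 ∷_) (compositions bs (suc n))) ⟩
  length (map (0 ∷_) (compositions bs (suc n))) + length (map bumpHead (compositions (true ∷ bs) n))
    ≡⟨ cong₂ _+_ (trans (LP.length-map (0 ∷_) (compositions bs (suc n))) (length-compositions bs (suc n)))
                 (trans (LP.length-map bumpHead (compositions (true ∷ bs) n)) (length-compositions (true ∷ bs) n)) ⟩
  (s + suc n ∸ 1) C suc n + (suc s + n ∸ 1) C n
    ≡⟨ cong (λ a → (a ∸ 1) C suc n + (s + n) C n) (NP.+-suc s n) ⟩
  (s + n) C suc n + (s + n) C n
    ≡⟨ NP.+-comm ((s + n) C suc n) _ ⟩
  (s + n) C n + (s + n) C suc n
    ≡⟨ nCk+nC[k+1]≡[n+1]C[k+1] (s + n) n ⟩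
  suc (s + n) C suc n
    ≡⟨ cong (_C suc n) (sym (NP.+-suc s n)) ⟩
  (suc s + suc n ∸ 1) C suc n ∎
  where open ≡-Reasoning
        s = openSlots bs

count-∷ : ∀ x l i → count (x ∷ l) i ≡ δ x i + count l i
count-∷ x l i with x ℕ.≟ i
... | yes x≡i = cong length (LP.filter-accept (ℕ._≟ i) x≡i)
... | no  x≢i = cong length (LP.filter-reject (ℕ._≟ i) x≢i)

count-++ : ∀ a b i → count (a ++ b) i ≡ count a i + count b i
count-++ a b i = trans (cong length (LP.filter-++ (ℕ._≟ i) a b)) (LP.length-++ (filter (ℕ._≟ i) a))

count-↭ : ∀ {a b} → a ↭ b → ∀ i → count a i ≡ count b i
count-↭ a↭b i = PermP.↭-length (PermP.filter-↭ (ℕ._≟ i) a↭b)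

count-replicate : ∀ r V i → count (replicate r V) i ≡ r ℕ.* δ V i
count-replicate zero    V i = refl
count-replicate (suc r) V i = trans (count-∷ V (replicate r V) i) (cong (_+_ (δ V i)) (count-replicate r V i))

δ-refl : ∀ x → δ x x ≡ 1
δ-refl x with x ℕ.≟ x
... | yes _  = refl
... | no x≢x = ⊥-elim (x≢x refl)

count-∈ : ∀ {x l} → x ∈ l → 1 ≤ count l x
count-∈ {x} {y ∷ l} (here refl) = subst (1 ≤_) (sym (trans (count-∷ x l x) (cong (_+ count l x) (δ-refl x)))) (s≤s z≤n)
count-∈ {x} {y ∷ l} (there x∈l) = subst (1 ≤_) (sym (count-∷ y l x)) (NP.≤-trans (count-∈ x∈l) (NP.m≤n+m _ (δ y x)))

count⇒∈ : ∀ x l → 1 ≤ count l x → x ∈ l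
count⇒∈ x (y ∷ l) c with y ℕ.≟ x | count-∷ y l x
... | yes refl | _  = here refl
... | no  y≢x  | eq = there (count⇒∈ x l (subst (1 ≤_) eq c))

count≡0⇒∉ : ∀ {x l} → count l x ≡ 0 → x ∉ l
count≡0⇒∉ c≡0 x∈l = NP.<⇒≢ (count-∈ x∈l) (sym c≡0)

count-≢ : ∀ V s → All (_≢ V) s → count s V ≡ 0
count-≢ V []      []          = refl
count-≢ V (x ∷ s) (x≢V ∷ s≢V) = trans (count-∷ x s V) (cong₂ _+_ (δ-≢ x≢V) (count-≢ V s s≢V))

same-counts⇒↭ : ∀ a b → (∀ i → count a i ≡ count b i) → a ↭ b
same-counts⇒↭ []      []      _    = Perm.refl
same-counts⇒↭ []      (y ∷ b) same = ⊥-elim (count≡0⇒∉ {y} {y ∷ b} (sym (same y)) (here refl))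
same-counts⇒↭ (x ∷ a) b       same with ∈⇒↭∷ x∈b
  where x∈b : x ∈ b
        x∈b = count⇒∈ x b (subst (1 ≤_) (same x) (count-∈ {x} {x ∷ a} (here refl)))
... | b′ , b↭xb′ = ↭-trans (Perm.prep x (same-counts⇒↭ a b′ same′)) (↭-sym b↭xb′)
  where same′ : ∀ i → count a i ≡ count b′ i
        same′ i = NP.+-cancelˡ-≡ (δ x i) _ _
          (trans (sym (count-∷ x a i)) (trans (same i) (trans (count-↭ b↭xb′ i) (count-∷ x b′ i))))

count-above : ∀ M l i → All (_≤ M) l → M < i → count l i ≡ 0
count-above M []      i []           _   = refl
count-above M (x ∷ l) i (x≤M ∷ l≤M) M<i =
  trans (count-∷ x l i) (cong₂ _+_ (δ-≢ (NP.<⇒≢ (NP.≤-<-trans x≤M M<i))) (count-above M l i l≤M M<i))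

bounded-by-counts : ∀ M t → (∀ i → M < i → count t i ≡ 0) → All (_≤ M) t
bounded-by-counts M t above = All.tabulate bounded
  where bounded : ∀ {y} → y ∈ t → y ≤ M
        bounded {y} y∈t = NP.≮⇒≥ (λ M<y → count≡0⇒∉ (above y M<y) y∈t)

Step : ℕ → ℕ → ℕ → Set
Step m a b = b ≤ a + m

-- An m-path starts at 0 and climbs by at most m at each step.  These are
-- exactly the sequences ω_m(B) of Ferrers boards.
MPath : ℕ → List ℕ → Set
MPath m []      = ⊤
MPath m (x ∷ t) = x ≡ 0 × Linked (Step m) (x ∷ t)

record PathWith (m M : ℕ) (cnt : ℕ → ℕ) (t : List ℕ) : Set where
  field
    path    : MPath m t
    counts  : ∀ i → i ≤ M → count t i ≡ cnt i
    bounded : ∀ i → M < i → count t i ≡ 0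

Leads : (ℕ → ℕ → Set) → ℕ → List ℕ → Set
Leads R x []      = ⊤
Leads R x (y ∷ _) = R x y

leads-∷ : ∀ {R x t} → Linked R (x ∷ t) → Leads R x t
leads-∷ [-]       = tt
leads-∷ (Rxy ∷ _) = Rxy

∷-leads : ∀ {R x t} → Leads R x t → Linked R t → Linked R (x ∷ t)
∷-leads {t = []}    _   _  = [-]
∷-leads {t = y ∷ t} Rxy Rt = Rxy ∷ Rt

leads-All : ∀ {R : ℕ → ℕ → Set} {P : ℕ → Set} x t → (∀ {y} → P y → R x y) → All P t → Leads R x t
leads-All x []      _ _          = tt
leads-All x (y ∷ t) f (py ∷ _) = f py

insertRuns : ℕ → List ℕ → List ℕ → List ℕ
insertRuns V []      rs       = []
insertRuns V (x ∷ s) []       = x ∷ insertRuns V s []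
insertRuns V (x ∷ s) (r ∷ rs) = x ∷ (replicate r V ++ insertRuns V s rs)

leads-insertRuns : ∀ {R} V x s rs → Leads R x s → Leads R x (insertRuns V s rs)
leads-insertRuns V x []      rs       l = tt
leads-insertRuns V x (y ∷ s) []       l = l
leads-insertRuns V x (y ∷ s) (r ∷ rs) l = l

leads-insertRuns⁻ : ∀ {R} V x s rs → Leads R x (insertRuns V s rs) → Leads R x s
leads-insertRuns⁻ V x []      rs       l = tt
leads-insertRuns⁻ V x (y ∷ s) []       l = l
leads-insertRuns⁻ V x (y ∷ s) (r ∷ rs) l = l

-- A run of V's may follow x in an m-path (whose other entries are < V)
-- exactly when V - m ≤ x < V.
CanPrecede : ℕ → ℕ → ℕ → Set
CanPrecede m V x = V ≤ x + m × x < V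

canPrecede? : ∀ m V x → Dec (CanPrecede m V x)
canPrecede? m V x = (V ≤? x + m) ×-dec (x <? V)

slotsFor : ℕ → ℕ → List ℕ → List Bool
slotsFor m V s = map (λ x → does (canPrecede? m V x)) s

does-true⇒ : ∀ {A : Set} (a? : Dec A) → does a? ≡ true → A
does-true⇒ (yes a) _ = a

length-fits : ∀ {bs rs} → Fits bs rs → length rs ≡ length bs
length-fits []             = refl
length-fits (closed fits)  = cong suc (length-fits fits)
length-fits (free _ fits) = cong suc (length-fits fits)

runs-path : ∀ m V r t → Linked (Step m) t → Leads (Step m) V t → Linked (Step m) (replicate r V ++ t)
runs-path m V zero          t p l = p
runs-path m V (suc zero)    t p l = ∷-leads l p
runs-path m V (suc (suc r)) t p l = NP.m≤m+n V m ∷ runs-path m V (suc r) t p l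

insertRuns-linked : ∀ m V s rs → Linked (Step m) s → All (_< V) s → Fits (slotsFor m V s) rs →
  Linked (Step m) (insertRuns V s rs)
insertRuns-linked m V []      rs       p []          fits = []
insertRuns-linked m V (x ∷ s) (r ∷ rs) p (x<V ∷ s<V) fits = ∷-leads (x-leads r fits) (runs-path m V r rest rest-path V-leads)
  where
  rest = insertRuns V s rs
  rest-path : Linked (Step m) rest
  rest-path = insertRuns-linked m V s rs (Linked.tail p) s<V (tail-fits fits)
    where tail-fits : ∀ {b bs r rs} → Fits (b ∷ bs) (r ∷ rs) → Fits bs rs
          tail-fits (closed f)  = f
          tail-fits (free _ f) = f
  V-leads : Leads (Step m) V rest
  V-leads = leads-insertRuns V V s rs (leads-All V s (λ y<V → NP.≤-trans (NP.<⇒≤ y<V) (NP.m≤m+n V m)) s<V)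
  x-leads : ∀ r → Fits (slotsFor m V (x ∷ s)) (r ∷ rs) → Leads (Step m) x (replicate r V ++ rest)
  x-leads zero    _ = leads-insertRuns V x s rs (leads-∷ p)
  x-leads (suc r) f = proj₁ (does-true⇒ (canPrecede? m V x) (open-slot f))
    where open-slot : ∀ {b bs r rs} → Fits (b ∷ bs) (suc r ∷ rs) → b ≡ true
          open-slot (free _ _) = refl

insertRuns-path : ∀ m V s rs → MPath m s → All (_< V) s → Fits (slotsFor m V s) rs → MPath m (insertRuns V s rs)
insertRuns-path m V []      rs       _           _   _    = tt
insertRuns-path m V (x ∷ s) (r ∷ rs) (x≡0 , p)   s<V fits = x≡0 , insertRuns-linked m V (x ∷ s) (r ∷ rs) p s<V fits

count-insertRuns-≢ : ∀ V s rs i → V ≢ i → length rs ≡ length s → count (insertRuns V s rs) i ≡ count s i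
count-insertRuns-≢ V []      rs       i V≢i len = refl
count-insertRuns-≢ V (x ∷ s) (r ∷ rs) i V≢i len = begin
  count (x ∷ (replicate r V ++ insertRuns V s rs)) i          ≡⟨ count-∷ x _ i ⟩
  δ x i + count (replicate r V ++ insertRuns V s rs) i        ≡⟨ cong (_+_ (δ x i)) (count-++ (replicate r V) _ i) ⟩
  δ x i + (count (replicate r V) i + count (insertRuns V s rs) i)
    ≡⟨ cong₂ (λ a b → δ x i + (a + b)) (trans (count-replicate r V i) (trans (cong (r *_) (δ-≢ V≢i)) (NP.*-zeroʳ r)))
                                         (count-insertRuns-≢ V s rs i V≢i (NP.suc-injective len)) ⟩
  δ x i + count s i                                           ≡⟨ sym (count-∷ x s i) ⟩
  count (x ∷ s) i                                             ∎
  where open ≡-Reasoning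

count-insertRuns-V : ∀ V s rs → length rs ≡ length s → count (insertRuns V s rs) V ≡ count s V + sum rs
count-insertRuns-V V []      []       len = refl
count-insertRuns-V V (x ∷ s) (r ∷ rs) len = begin
  count (x ∷ (replicate r V ++ insertRuns V s rs)) V           ≡⟨ count-∷ x _ V ⟩
  δ x V + count (replicate r V ++ insertRuns V s rs) V         ≡⟨ cong (_+_ (δ x V)) (count-++ (replicate r V) _ V) ⟩
  δ x V + (count (replicate r V) V + count (insertRuns V s rs) V)
    ≡⟨ cong₂ (λ a b → δ x V + (a + b)) (trans (count-replicate r V V) (trans (cong (r *_) (δ-refl V)) (NP.*-identityʳ r)))
                                         (count-insertRuns-V V s rs (NP.suc-injective len)) ⟩
  δ x V + (r + (count s V + sum rs))                           ≡⟨ regroup (δ x V) r (count s V) (sum rs) ⟩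
  (δ x V + count s V) + (r + sum rs)                           ≡⟨ cong (_+ (r + sum rs)) (sym (count-∷ x s V)) ⟩
  count (x ∷ s) V + sum (r ∷ rs)                               ∎
  where open ≡-Reasoning
        regroup : ∀ a r c d → a + (r + (c + d)) ≡ (a + c) + (r + d)
        regroup = ℕ-Solver.solve-∀

extensions : ℕ → ℕ → ℕ → List ℕ → List (List ℕ)
extensions m V n s = map (insertRuns V s) (compositions (slotsFor m V s) n)

paths : ℕ → ℕ → (ℕ → ℕ) → List (List ℕ)
paths m zero    cnt = replicate (cnt 0) 0 ∷ []
paths m (suc M) cnt = concatMap (extensions m (suc M) (cnt (suc M))) (paths m M cnt)

∈-concatMap⁻ : ∀ {A B : Set} (g : A → List B) xs {v} → v ∈ concatMap g xs → ∃ λ x → x ∈ xs × v ∈ g x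
∈-concatMap⁻ g xs v∈ with MP.∈-concat⁻′ (map g xs) v∈
... | ys , v∈ys , ys∈ with MP.∈-map⁻ g ys∈
...   | x , x∈xs , refl = x , x∈xs , v∈ys

∈-concatMap⁺ : ∀ {A B : Set} (g : A → List B) {xs x v} → x ∈ xs → v ∈ g x → v ∈ concatMap g xs
∈-concatMap⁺ g x∈xs v∈gx = MP.∈-concat⁺′ v∈gx (MP.∈-map⁺ g x∈xs)

composition-length : ∀ m V n s {rs} → rs ∈ compositions (slotsFor m V s) n → length rs ≡ length s
composition-length m V n s mem = trans (length-fits (proj₁ (compositions-sound (slotsFor m V s) n mem))) (LP.length-map _ s)

zeros-path : ∀ m n → MPath m (replicate n 0)
zeros-path m zero          = tt
zeros-path m (suc zero)    = refl , [-]
zeros-path m (suc (suc n)) = refl , z≤n ∷ proj₂ (zeros-path m (suc n))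

paths-sound : ∀ m M cnt {t} → t ∈ paths m M cnt → PathWith m M cnt t
paths-sound m zero    cnt (here refl) = record
  { path    = zeros-path m (cnt 0)
  ; counts  = λ { .0 z≤n → trans (count-replicate (cnt 0) 0 0) (NP.*-identityʳ (cnt 0)) }
  ; bounded = λ i 0<i → trans (count-replicate (cnt 0) 0 i) (trans (cong (cnt 0 *_) (δ-≢ (NP.<⇒≢ 0<i))) (NP.*-zeroʳ (cnt 0)))
  }
paths-sound m (suc M) cnt t∈ with ∈-concatMap⁻ (extensions m (suc M) (cnt (suc M))) (paths m M cnt) t∈
... | s , s∈ , t∈ext with MP.∈-map⁻ (insertRuns (suc M) s) t∈ext
...   | rs , rs∈ , refl = record { path = path ; counts = counts ; bounded = bounded }
  where
  V = suc M
  module S = PathWith (paths-sound m M cnt s∈)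
  fits×sum = compositions-sound (slotsFor m V s) (cnt V) rs∈
  len : length rs ≡ length s
  len = composition-length m V (cnt V) s rs∈
  path : MPath m (insertRuns V s rs)
  path = insertRuns-path m V s rs S.path (All.map s≤s (bounded-by-counts M s S.bounded)) (proj₁ fits×sum)
  counts : ∀ i → i ≤ V → count (insertRuns V s rs) i ≡ cnt i
  counts i i≤V with i ℕ.≟ V
  ... | yes refl = trans (count-insertRuns-V V s rs len) (cong₂ _+_ (S.bounded V NP.≤-refl) (proj₂ fits×sum))
  ... | no  i≢V  = trans (count-insertRuns-≢ V s rs i (λ e → i≢V (sym e)) len) (S.counts i (NP.≤-pred (NP.≤∧≢⇒< i≤V i≢V)))
  bounded : ∀ i → V < i → count (insertRuns V s rs) i ≡ 0
  bounded i V<i = trans (count-insertRuns-≢ V s rs i (NP.<⇒≢ V<i) len) (S.bounded i (NP.<-trans (NP.n<1+n M) V<i))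

record Decomposition (V : ℕ) (t : List ℕ) : Set where
  field
    lead        : ℕ
    others      : List ℕ
    runs        : List ℕ
    others≢V    : All (_≢ V) others
    runs-length : length runs ≡ length others
    recompose   : t ≡ replicate lead V ++ insertRuns V others runs

decompose : ∀ V t → Decomposition V t
decompose V []      = record { lead = 0 ; others = [] ; runs = [] ; others≢V = [] ; runs-length = refl ; recompose = refl }
decompose V (y ∷ t) with y ℕ.≟ V | decompose V t
... | yes refl | d = record
  { lead = suc lead ; others = others ; runs = runs ; others≢V = others≢V ; runs-length = runs-length
  ; recompose = cong (y ∷_) recompose }
  where open Decomposition d
... | no  y≢V  | d = record
  { lead        = 0
  ; others      = y ∷ others
  ; runs        = lead ∷ runs
  ; others≢V    = y≢V ∷ others≢V
  ; runs-length = cong suc runs-length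
  ; recompose   = cong (y ∷_) recompose
  }
  where open Decomposition d

no-lead : ∀ V t → Leads _≢_ V t → Decomposition.lead (decompose V t) ≡ 0
no-lead V t V≢head with Decomposition.lead (decompose V t) | Decomposition.recompose (decompose V t)
... | zero  | _ = refl
... | suc _ | t≡ = ⊥-elim (subst (Leads _≢_ V) t≡ V≢head refl)

insertRuns-linked⁻ : ∀ m V s rs → length rs ≡ length s → All (_≢ V) s →
  Linked (Step m) (insertRuns V s rs) → All (_≤ V) (insertRuns V s rs) →
  Linked (Step m) s × Fits (slotsFor m V s) rs
insertRuns-linked⁻ m V []      []       _   _            _ _ = [] , []
insertRuns-linked⁻ m V (x ∷ s) (r ∷ rs) len (x≢V ∷ s≢V) p (x≤V ∷ t≤V) =
  ∷-leads (leads-insertRuns⁻ V x s rs (x-leads r p)) (proj₁ ih) , fit r p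
  where
  rest = insertRuns V s rs
  rest≤V : All (_≤ V) rest
  rest≤V = AllP.++⁻ʳ (replicate r V) t≤V
  ih = insertRuns-linked⁻ m V s rs (NP.suc-injective len) s≢V (drop-run r (Linked.tail p)) rest≤V
    where drop-run : ∀ r {t} → Linked (Step m) (replicate r V ++ t) → Linked (Step m) t
          drop-run zero    q = q
          drop-run (suc r) q = drop-run r (Linked.tail q)
  x-leads : ∀ r → Linked (Step m) (x ∷ (replicate r V ++ rest)) → Leads (Step m) x rest
  x-leads zero    q = leads-∷ q
  x-leads (suc r) q = leads-All x rest (λ y≤V → NP.≤-trans y≤V (leads-∷ q)) rest≤V
  fit : ∀ r → Linked (Step m) (x ∷ (replicate r V ++ rest)) → Fits (slotsFor m V (x ∷ s)) (r ∷ rs)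
  fit zero    _ = zero-part (does (canPrecede? m V x)) (proj₂ ih)
    where zero-part : ∀ b → Fits (slotsFor m V s) rs → Fits (b ∷ slotsFor m V s) (0 ∷ rs)
          zero-part false f = closed f
          zero-part true  f = free 0 f
  fit (suc r) q rewrite dec-true (canPrecede? m V x) (leads-∷ q , NP.≤∧≢⇒< x≤V x≢V) = free (suc r) (proj₂ ih)

mpath-linked : ∀ {m t} → MPath m t → Linked (Step m) t
mpath-linked {t = []}    _       = []
mpath-linked {t = _ ∷ _} (_ , p) = p

mpath-insertRuns⁻ : ∀ m V s rs → MPath m (insertRuns V s rs) → Linked (Step m) s → MPath m s
mpath-insertRuns⁻ m V []      rs       _         _ = tt
mpath-insertRuns⁻ m V (x ∷ s) []       (x≡0 , _) p = x≡0 , p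
mpath-insertRuns⁻ m V (x ∷ s) (r ∷ rs) (x≡0 , _) p = x≡0 , p

mpath-head≢ : ∀ m M t → MPath m t → Leads _≢_ (suc M) t
mpath-head≢ m M []      _         = tt
mpath-head≢ m M (x ∷ t) (x≡0 , _) = λ V≡x → NP.0≢1+n (trans (sym x≡0) (sym V≡x))

-- Every m-path with the prescribed multiplicities is generated: removing
-- the copies of the largest value V leaves a path for V - 1 with V's runs
-- at allowed slots.
paths-complete : ∀ m M cnt t → PathWith m M cnt t → t ∈ paths m M cnt
paths-complete m zero    cnt t p = here (begin
  t                                 ≡⟨ all-zero t (bounded-by-counts 0 t bounded) ⟩
  replicate (count t 0) 0           ≡⟨ cong (λ n → replicate n 0) (counts 0 z≤n) ⟩
  replicate (cnt 0) 0               ∎)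
  where
  open ≡-Reasoning
  open PathWith p
  all-zero : ∀ t → All (_≤ 0) t → t ≡ replicate (count t 0) 0
  all-zero []      []           = refl
  all-zero (0 ∷ t) (z≤n ∷ t≤0) = cong (0 ∷_) (all-zero t t≤0)
paths-complete m (suc M) cnt t p =
  ∈-concatMap⁺ (extensions m V (cnt V)) s∈ (subst (_∈ extensions m V (cnt V) s) (sym t≡) (MP.∈-map⁺ (insertRuns V s) rs∈))
  where
  V = suc M
  open PathWith p
  open Decomposition (decompose V t) renaming (others to s; runs to rs)
  t≡ : t ≡ insertRuns V s rs
  t≡ = trans recompose (cong (λ n → replicate n V ++ insertRuns V s rs) (no-lead V t (mpath-head≢ m M t path)))
  inverse : Linked (Step m) s × Fits (slotsFor m V s) rs
  inverse = insertRuns-linked⁻ m V s rs runs-length others≢V (subst (Linked (Step m)) t≡ (mpath-linked path))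
                               (subst (All (_≤ V)) t≡ (bounded-by-counts V t bounded))
  s-counts : ∀ i → V ≢ i → count s i ≡ count t i
  s-counts i V≢i = trans (sym (count-insertRuns-≢ V s rs i V≢i runs-length)) (cong (λ u → count u i) (sym t≡))
  s∈ : s ∈ paths m M cnt
  s∈ = paths-complete m M cnt s (record
    { path    = mpath-insertRuns⁻ m V s rs (subst (MPath m) t≡ path) (proj₁ inverse)
    ; counts  = λ i i≤M → trans (s-counts i (NP.>⇒≢ (s≤s i≤M))) (counts i (NP.m≤n⇒m≤1+n i≤M))
    ; bounded = s-bounded
    })
    where
    s-bounded : ∀ i → M < i → count s i ≡ 0
    s-bounded i M<i with i ℕ.≟ V
    ... | yes refl = count-≢ V s others≢V
    ... | no  i≢V  = trans (s-counts i (λ e → i≢V (sym e))) (bounded i (NP.≤∧≢⇒< M<i (λ e → i≢V (sym e))))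
  runs-sum : sum rs ≡ cnt V
  runs-sum = begin
    sum rs                 ≡⟨ cong (_+ sum rs) (sym (count-≢ V s others≢V)) ⟩
    count s V + sum rs     ≡⟨ sym (count-insertRuns-V V s rs runs-length) ⟩
    count (insertRuns V s rs) V ≡⟨ cong (λ u → count u V) (sym t≡) ⟩
    count t V              ≡⟨ counts V NP.≤-refl ⟩
    cnt V                  ∎
    where open ≡-Reasoning
  rs∈ : rs ∈ compositions (slotsFor m V s) (cnt V)
  rs∈ = subst (λ n → rs ∈ compositions (slotsFor m V s) n) runs-sum (compositions-complete (slotsFor m V s) rs (proj₂ inverse))

runs-split : ∀ V r r′ t t′ → Leads _≢_ V t → Leads _≢_ V t′ →
  replicate r V ++ t ≡ replicate r′ V ++ t′ → r ≡ r′ × t ≡ t′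
runs-split V zero    zero     t t′ _ _ e = refl , e
runs-split V zero    (suc r′) (y ∷ t) t′ V≢y _ e = ⊥-elim (V≢y (sym (LP.∷-injectiveˡ e)))
runs-split V (suc r) zero     t (y ∷ t′) _ V≢y e = ⊥-elim (V≢y (LP.∷-injectiveˡ e))
runs-split V (suc r) (suc r′) t t′ l l′ e with runs-split V r r′ t t′ l l′ (LP.∷-injectiveʳ e)
... | r≡r′ , t≡t′ = cong suc r≡r′ , t≡t′

insertRuns-leads≢ : ∀ V s rs → All (_≢ V) s → Leads _≢_ V (insertRuns V s rs)
insertRuns-leads≢ V s rs s≢V = leads-insertRuns V V s rs (leads-All V s (λ y≢V V≡y → y≢V (sym V≡y)) s≢V)

insertRuns-injective : ∀ V s s′ rs rs′ → All (_≢ V) s → All (_≢ V) s′ → length rs ≡ length s → length rs′ ≡ length s′ →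
  insertRuns V s rs ≡ insertRuns V s′ rs′ → s ≡ s′ × rs ≡ rs′
insertRuns-injective V []      []        []       []         _ _ _ _ _ = refl , refl
insertRuns-injective V []      []        []       (_ ∷ _)    _ _ _ () _
insertRuns-injective V []      (_ ∷ _)   _        (_ ∷ _)    _ _ _ _ ()
insertRuns-injective V (_ ∷ _) []        (_ ∷ _)  _          _ _ _ _ ()
insertRuns-injective V (x ∷ s) (x′ ∷ s′) (r ∷ rs) (r′ ∷ rs′) (_ ∷ s≢V) (_ ∷ s′≢V) len len′ e
  with LP.∷-injectiveˡ e
     | runs-split V r r′ _ _ (insertRuns-leads≢ V s rs s≢V) (insertRuns-leads≢ V s′ rs′ s′≢V) (LP.∷-injectiveʳ e)
... | refl | refl , rest≡ with insertRuns-injective V s s′ rs rs′ s≢V s′≢V (NP.suc-injective len) (NP.suc-injective len′) rest≡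
...   | refl , refl = refl , refl

unique-map-on : ∀ {A B : Set} (g : A → B) xs → Unique xs →
  (∀ {x y} → x ∈ xs → y ∈ xs → g x ≡ g y → x ≡ y) → Unique (map g xs)
unique-map-on g []       []          inj = []
unique-map-on g (x ∷ xs) (x∉ ∷ uniq) inj = All.tabulate fresh ∷ unique-map-on g xs uniq (λ p q → inj (there p) (there q))
  where
  fresh : ∀ {v} → v ∈ map g xs → g x ≢ v
  fresh v∈ gx≡v with MP.∈-map⁻ g v∈
  ... | y , y∈ , refl = All.lookup x∉ y∈ (inj (here refl) (there y∈) gx≡v)

unique-concatMap : ∀ {A B : Set} (g : A → List B) xs → Unique xs → (∀ {x} → x ∈ xs → Unique (g x)) →
  (∀ {x y z} → x ∈ xs → y ∈ xs → z ∈ g x → z ∈ g y → x ≡ y) → Unique (concatMap g xs)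
unique-concatMap g []       []          _     _        = []
unique-concatMap g (x ∷ xs) (x∉ ∷ uniq) uniqg disjoint =
  UP.++⁺ (uniqg (here refl)) (unique-concatMap g xs uniq (uniqg ∘ there) (λ p q → disjoint (there p) (there q))) apart
  where
  apart : ∀ {v} → ¬ (v ∈ g x × v ∈ concatMap g xs)
  apart (v∈gx , v∈rest) with ∈-concatMap⁻ g xs v∈rest
  ... | y , y∈ , v∈gy = All.lookup x∉ y∈ (disjoint (here refl) (there y∈) v∈gx v∈gy)

paths-unique : ∀ m M cnt → Unique (paths m M cnt)
paths-unique m zero    cnt = [] ∷ []
paths-unique m (suc M) cnt = unique-concatMap (extensions m V (cnt V)) (paths m M cnt) (paths-unique m M cnt) unique-ext disjoint
  where
  V = suc M
  no-V : ∀ {s} → s ∈ paths m M cnt → All (_≢ V) s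
  no-V s∈ = All.map (λ y≤M → NP.<⇒≢ (s≤s y≤M)) (bounded-by-counts M _ (PathWith.bounded (paths-sound m M cnt s∈)))
  unique-ext : ∀ {s} → s ∈ paths m M cnt → Unique (extensions m V (cnt V) s)
  unique-ext {s} s∈ = unique-map-on (insertRuns V s) _ (compositions-unique (slotsFor m V s) (cnt V))
    (λ p q e → proj₂ (insertRuns-injective V s s _ _ (no-V s∈) (no-V s∈) (composition-length m V (cnt V) s p) (composition-length m V (cnt V) s q) e))
  disjoint : ∀ {s s′ t} → s ∈ paths m M cnt → s′ ∈ paths m M cnt → t ∈ extensions m V (cnt V) s → t ∈ extensions m V (cnt V) s′ → s ≡ s′
  disjoint {s} {s′} s∈ s′∈ t∈ t∈′ with MP.∈-map⁻ (insertRuns V s) t∈ | MP.∈-map⁻ (insertRuns V s′) t∈′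
  ... | rs , rs∈ , refl | rs′ , rs′∈ , e =
    proj₁ (insertRuns-injective V s s′ rs rs′ (no-V s∈) (no-V s′∈) (composition-length m V (cnt V) s rs∈) (composition-length m V (cnt V) s′ rs′∈) e)

length-concatMap : ∀ {A B : Set} (g : A → List B) xs K → (∀ {x} → x ∈ xs → length (g x) ≡ K) →
  length (concatMap g xs) ≡ length xs * K
length-concatMap g []       K same = refl
length-concatMap g (x ∷ xs) K same =
  trans (LP.length-++ (g x)) (cong₂ _+_ (same (here refl)) (length-concatMap g xs K (same ∘ there)))

openSlots-∷ : ∀ b bs → openSlots (b ∷ bs) ≡ openSlots (b ∷ []) + openSlots bs
openSlots-∷ true  bs = refl
openSlots-∷ false bs = refl

-- A run of V may follow x exactly when x lies in the window V - m, …, V - 1,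
-- which starts at a = V ∸ m and has ℓ = V ∸ (V ∸ m) values.
slot-indicator : ∀ m V x (slot? : Dec (CanPrecede m V x)) →
  openSlots (does slot? ∷ []) ≡ Σℕ (λ t → δ x ((V ∸ m) + t)) (V ∸ (V ∸ m))
slot-indicator m V x (yes (V≤x+m , x<V)) = sym (Σℕ-δ-inside x a ℓ (subst (a ≤_) (NP.m+n∸n≡m x m) (NP.∸-monoˡ-≤ m V≤x+m)) (subst (x <_) (sym a+ℓ≡V) x<V))
  where a = V ∸ m
        ℓ = V ∸ (V ∸ m)
        a+ℓ≡V = NP.m+[n∸m]≡n (NP.m∸n≤m V m)
slot-indicator m V x (no ¬slot) = sym (Σℕ-δ-outside x a ℓ outside)
  where
  a = V ∸ m
  ℓ = V ∸ (V ∸ m)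
  a+ℓ≡V = NP.m+[n∸m]≡n (NP.m∸n≤m V m)
  outside : x < a ⊎ a + ℓ ≤ x
  outside with x ℕ.<? V
  ... | no  x≮V = inj₂ (subst (_≤ x) (sym a+ℓ≡V) (NP.≮⇒≥ x≮V))
  ... | yes x<V = inj₁ (subst (_≤ a) (NP.m+n∸n≡m (suc x) m) (NP.∸-monoˡ-≤ m (NP.≰⇒> (λ V≤x+m → ¬slot (V≤x+m , x<V)))))

openSlots-slotsFor : ∀ m V s → openSlots (slotsFor m V s) ≡ Σℕ (λ t → count s ((V ∸ m) + t)) (V ∸ (V ∸ m))
openSlots-slotsFor m V []      = sym (Σℕ-zero (V ∸ (V ∸ m)))
openSlots-slotsFor m V (x ∷ s) = begin
  openSlots (does (canPrecede? m V x) ∷ slotsFor m V s)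
    ≡⟨ openSlots-∷ (does (canPrecede? m V x)) (slotsFor m V s) ⟩
  openSlots (does (canPrecede? m V x) ∷ []) + openSlots (slotsFor m V s)
    ≡⟨ cong₂ _+_ (slot-indicator m V x (canPrecede? m V x)) (openSlots-slotsFor m V s) ⟩
  Σℕ (λ t → δ x (a + t)) ℓ + Σℕ (λ t → count s (a + t)) ℓ
    ≡⟨ sym (Σℕ-+ (λ t → δ x (a + t)) (λ t → count s (a + t)) ℓ) ⟩
  Σℕ (λ t → δ x (a + t) + count s (a + t)) ℓ
    ≡⟨ Σℕ-cong ℓ (λ t _ → sym (count-∷ x s (a + t))) ⟩
  Σℕ (λ t → count (x ∷ s) (a + t)) ℓ ∎
  where
  open ≡-Reasoning
  a = V ∸ m
  ℓ = V ∸ (V ∸ m)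

windowSum : ℕ → (ℕ → ℕ) → ℕ → ℕ
windowSum m cnt i = Σℕ (λ t → cnt (i ∸ m + t)) (suc (i ∸ (i ∸ m)))

-- The number of m-paths with multiplicities cnt on 0..M: each value V = i+1
-- contributes the number C(n_{V-1} + ⋯ + n_{V-m} + n_V - 1, n_V) of
-- compositions of n_V over its open slots.
length-paths : ∀ m M cnt → length (paths m M cnt) ≡ Πℕ (λ i → (windowSum m cnt (suc i) ∸ 1) C cnt (suc i)) M
length-paths m zero    cnt = refl
length-paths m (suc M) cnt = begin
  length (concatMap (extensions m V (cnt V)) (paths m M cnt)) ≡⟨ length-concatMap (extensions m V (cnt V)) (paths m M cnt) K same ⟩
  length (paths m M cnt) * K                                   ≡⟨ cong (_* K) (length-paths m M cnt) ⟩
  Πℕ (λ i → (windowSum m cnt (suc i) ∸ 1) C cnt (suc i)) M * K ∎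
  where
  open ≡-Reasoning
  V = suc M
  a = V ∸ m
  ℓ = V ∸ (V ∸ m)
  K = (windowSum m cnt V ∸ 1) C cnt V
  window-V : windowSum m cnt V ≡ Σℕ (λ t → cnt (a + t)) ℓ + cnt V
  window-V = cong (_+_ (Σℕ (λ t → cnt (a + t)) ℓ)) (cong cnt (NP.m+[n∸m]≡n (NP.m∸n≤m V m)))
  same : ∀ {s} → s ∈ paths m M cnt → length (extensions m V (cnt V) s) ≡ K
  same {s} s∈ = begin
    length (extensions m V (cnt V) s)                       ≡⟨ LP.length-map (insertRuns V s) (compositions (slotsFor m V s) (cnt V)) ⟩
    length (compositions (slotsFor m V s) (cnt V))          ≡⟨ length-compositions (slotsFor m V s) (cnt V) ⟩
    (openSlots (slotsFor m V s) + cnt V ∸ 1) C cnt V        ≡⟨ cong (λ w → (w + cnt V ∸ 1) C cnt V) (trans (openSlots-slotsFor m V s) slots≡) ⟩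
    (Σℕ (λ t → cnt (a + t)) ℓ + cnt V ∸ 1) C cnt V          ≡⟨ cong (λ w → (w ∸ 1) C cnt V) (sym window-V) ⟩
    K                                                       ∎
    where
    slots≡ : Σℕ (λ t → count s (a + t)) ℓ ≡ Σℕ (λ t → cnt (a + t)) ℓ
    slots≡ = Σℕ-cong ℓ (λ t t<ℓ → PathWith.counts (paths-sound m M cnt s∈) (a + t)
               (NP.≤-pred (subst (a + t <_) (NP.m+[n∸m]≡n (NP.m∸n≤m V m)) (NP.+-monoʳ-< a t<ℓ))))

+∸≤∸+ : ∀ a m b → (m + a) ∸ b ≤ (a ∸ b) + m
+∸≤∸+ a       m zero    = NP.≤-reflexive (NP.+-comm m a)
+∸≤∸+ zero    m (suc b) = NP.≤-trans (NP.m∸n≤m (m + 0) (suc b)) (NP.≤-reflexive (NP.+-identityʳ m))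
+∸≤∸+ (suc a) m (suc b) = subst (_≤ (a ∸ b) + m) (sym (cong (_∸ suc b) (NP.+-suc m a))) (+∸≤∸+ a m b)

omegaFrom-path : ∀ m j p → Linked _≤_ p → Linked (Step m) (omegaFrom m j p)
omegaFrom-path m j []           _            = []
omegaFrom-path m j (b ∷ [])     _            = [-]
omegaFrom-path m j (b ∷ b′ ∷ p) (b≤b′ ∷ sorted) =
  NP.≤-trans (NP.∸-monoʳ-≤ (suc j * m) b≤b′) (+∸≤∸+ (j * m) m b) ∷ omegaFrom-path m (suc j) (b′ ∷ p) sorted

omegaFrom-sorted : ∀ m j c → UnderLine m j c → Linked (Step m) c → Linked _≤_ (omegaFrom m j c)
omegaFrom-sorted m j []          _          _            = []
omegaFrom-sorted m j (x ∷ [])    _          _            = [-]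
omegaFrom-sorted m j (x ∷ y ∷ c) (x≤ , ul) (y≤x+m ∷ p) = step ∷ omegaFrom-sorted m (suc j) (y ∷ c) ul p
  where step : j * m ∸ x ≤ suc j * m ∸ y
        step = subst (_≤ suc j * m ∸ y) (trans (cong ((m + j * m) ∸_) (NP.+-comm x m)) (NP.[m+n]∸[m+o]≡n∸o m (j * m) x))
                     (NP.∸-monoʳ-≤ (suc j * m) y≤x+m)

mpath-underLine : ∀ m c → MPath m c → UnderLine m 0 c
mpath-underLine m []      _         = tt
mpath-underLine m (x ∷ t) (x≡0 , p) = go 0 x t (NP.≤-reflexive x≡0) p
  where
  go : ∀ j x t → x ≤ j * m → Linked (Step m) (x ∷ t) → UnderLine m j (x ∷ t)
  go j x []      x≤ _           = x≤ , tt
  go j x (y ∷ t) x≤ (y≤x+m ∷ p) =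
    x≤ , go (suc j) y t (NP.≤-trans y≤x+m (subst (x + m ≤_) (NP.+-comm (j * m) m) (NP.+-monoˡ-≤ m x≤))) p

omegaFrom-involutive : ∀ m j c → UnderLine m j c → omegaFrom m j (omegaFrom m j c) ≡ c
omegaFrom-involutive m j []      _         = refl
omegaFrom-involutive m j (x ∷ c) (x≤ , ul) = cong₂ _∷_ (NP.m∸[m∸n]≡n x≤) (omegaFrom-involutive m (suc j) c ul)

omegaFrom-sum : ∀ m j c → UnderLine m j c → sum (omegaFrom m j c) + sum c ≡ Σℕ (λ i → (j + i) * m) (length c)
omegaFrom-sum m j []      _         = refl
omegaFrom-sum m j (x ∷ c) (x≤ , ul) = begin
  ((j * m ∸ x) + sum (omegaFrom m (suc j) c)) + (x + sum c) ≡⟨ regroup (j * m ∸ x) (sum (omegaFrom m (suc j) c)) x (sum c) ⟩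
  ((j * m ∸ x) + x) + (sum (omegaFrom m (suc j) c) + sum c) ≡⟨ cong₂ _+_ (NP.m∸n+n≡m x≤) (omegaFrom-sum m (suc j) c ul) ⟩
  j * m + Σℕ (λ i → (suc j + i) * m) (length c)
    ≡⟨ cong₂ (λ a b → a * m + b) (sym (NP.+-identityʳ j)) (Σℕ-cong (length c) (λ i _ → cong (_* m) (sym (NP.+-suc j i)))) ⟩
  (j + 0) * m + Σℕ (λ i → (j + suc i) * m) (length c)      ≡⟨ sym (Σℕ-suc (λ i → (j + i) * m) (length c)) ⟩
  Σℕ (λ i → (j + i) * m) (suc (length c))                  ∎
  where
  open ≡-Reasoning
  regroup : ∀ a b c d → (a + b) + (c + d) ≡ (a + c) + (b + d)
  regroup = ℕ-Solver.solve-∀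

omegaFrom-bound : ∀ m j p K → j + length p ≤ suc K → All (_≤ K * m) (omegaFrom m j p)
omegaFrom-bound m j []      K _  = []
omegaFrom-bound m j (b ∷ p) K le =
  NP.≤-trans (NP.m∸n≤m (j * m) b) (NP.*-monoˡ-≤ m j≤K) ∷ omegaFrom-bound m (suc j) p K (subst (_≤ suc K) (NP.+-suc j (length p)) le)
  where j≤K : j ≤ K
        j≤K = NP.≤-pred (NP.≤-trans (s≤s (NP.m≤m+n j (length p))) (subst (_≤ suc K) (NP.+-suc j (length p)) le))

omegaFrom-mpath : ∀ m p → Linked _≤_ p → MPath m (omegaFrom m 0 p)
omegaFrom-mpath m []      _      = tt
omegaFrom-mpath m (b ∷ p) sorted = NP.0∸n≡0 b , omegaFrom-path m 0 (b ∷ p) sorted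

padded-sorted : ∀ h → Linked _≤_ h → Linked _≤_ (padded h)
padded-sorted h sorted = zeros (padding h)
  where zeros : ∀ z → Linked _≤_ (replicate z 0 ++ h)
        zeros zero          = sorted
        zeros (suc zero)    = ∷-leads (leads-0 h) sorted
          where leads-0 : ∀ t → Leads _≤_ 0 t
                leads-0 []      = tt
                leads-0 (_ ∷ _) = z≤n
        zeros (suc (suc z)) = z≤n ∷ zeros (suc z)

sum-padded : ∀ h → sum (padded h) ≡ cells h
sum-padded h = trans (sum-++ (replicate (padding h) 0) h) (cong (_+ sum h) (zeros (padding h)))
  where zeros : ∀ z → sum (replicate z 0) ≡ 0
        zeros zero    = refl
        zeros (suc z) = zeros z

omega-mpath : ∀ m h → IsFerrers h → MPath m (omega m h)
omega-mpath m h ferrers = subst (MPath m) (sym (omega≡omegaFrom m h ferrers))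
  (omegaFrom-mpath m (padded h) (padded-sorted h (proj₁ ferrers)))

omega-bound : ∀ m h → IsFerrers h → All (_≤ cells h * m) (omega m h)
omega-bound m h ferrers = subst (All (_≤ cells h * m)) (sym (omega≡omegaFrom m h ferrers))
  (omegaFrom-bound m 0 (padded h) (cells h) (NP.≤-reflexive (length-padded h ferrers)))

dropZeros : List ℕ → List ℕ
dropZeros []          = []
dropZeros (zero ∷ l)  = dropZeros l
dropZeros (suc x ∷ l) = suc x ∷ l

leadingZeros : List ℕ → ℕ
leadingZeros []          = 0
leadingZeros (zero ∷ l)  = suc (leadingZeros l)
leadingZeros (suc _ ∷ _) = 0

zeros++dropZeros : ∀ l → l ≡ replicate (leadingZeros l) 0 ++ dropZeros l
zeros++dropZeros []          = refl
zeros++dropZeros (zero ∷ l)  = cong (0 ∷_) (zeros++dropZeros l)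
zeros++dropZeros (suc x ∷ l) = refl

sum-dropZeros : ∀ l → sum (dropZeros l) ≡ sum l
sum-dropZeros []          = refl
sum-dropZeros (zero ∷ l)  = sum-dropZeros l
sum-dropZeros (suc x ∷ l) = refl

dropZeros-ferrers : ∀ l → Linked _≤_ l → IsFerrers (dropZeros l)
dropZeros-ferrers []          _      = [] , []
dropZeros-ferrers (zero ∷ l)  sorted = dropZeros-ferrers l (Linked.tail sorted)
dropZeros-ferrers (suc x ∷ l) sorted = sorted , All.map (NP.<-≤-trans (s≤s z≤n)) (LinkedP.Linked⇒All NP.≤-trans NP.≤-refl sorted)

dropZeros-zeros : ∀ z h → All (0 <_) h → dropZeros (replicate z 0 ++ h) ≡ h
dropZeros-zeros (suc z) h           h>0 = dropZeros-zeros z h h>0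
dropZeros-zeros zero    []          []  = refl
dropZeros-zeros zero    (suc _ ∷ _) _   = refl
dropZeros-zeros zero    (zero ∷ _)  (() ∷ _)

dropZeros-padded : ∀ h → IsFerrers h → dropZeros (padded h) ≡ h
dropZeros-padded h (_ , h>0) = dropZeros-zeros (padding h) h h>0

toBoard : ℕ → List ℕ → List ℕ
toBoard m c = dropZeros (omegaFrom m 0 c)

toBoard-omega : ∀ m h → 1 ≤ m → IsFerrers h → toBoard m (omega m h) ≡ h
toBoard-omega m h 1≤m ferrers = begin
  dropZeros (omegaFrom m 0 (omega m h))                      ≡⟨ cong (dropZeros ∘ omegaFrom m 0) (omega≡omegaFrom m h ferrers) ⟩
  dropZeros (omegaFrom m 0 (omegaFrom m 0 (padded h)))       ≡⟨ cong dropZeros (omegaFrom-involutive m 0 (padded h) (underLine-padded m h 1≤m ferrers)) ⟩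
  dropZeros (padded h)                                       ≡⟨ dropZeros-padded h ferrers ⟩
  h                                                          ∎
  where open ≡-Reasoning

omega-toBoard : ∀ m N c → MPath m c → length c ≡ suc N → sum (omegaFrom m 0 c) ≡ N →
  IsFerrers (toBoard m c) × omega m (toBoard m c) ≡ c
omega-toBoard m N c path len cells≡ = ferrers , (begin
  omega m h                       ≡⟨ omega≡omegaFrom m h ferrers ⟩
  omegaFrom m 0 (padded h)        ≡⟨ cong (omegaFrom m 0) padded≡b ⟩
  omegaFrom m 0 b                 ≡⟨ omegaFrom-involutive m 0 c under ⟩
  c                               ∎)
  where
  open ≡-Reasoning
  under = mpath-underLine m c path
  b = omegaFrom m 0 c
  h = dropZeros b
  ferrers : IsFerrers h
  ferrers = dropZeros-ferrers b (omegaFrom-sorted m 0 c under (mpath-linked path))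
  cells-h : cells h ≡ N
  cells-h = trans (sum-dropZeros b) cells≡
  padded≡b : padded h ≡ b
  padded≡b = trans (cong (λ z → replicate z 0 ++ h) zeros≡) (sym (zeros++dropZeros b))
    where
    split-length : leadingZeros b + length h ≡ suc N
    split-length = begin
      leadingZeros b + length h                         ≡⟨ cong (_+ length h) (sym (LP.length-replicate (leadingZeros b))) ⟩
      length (replicate (leadingZeros b) 0) + length h  ≡⟨ sym (LP.length-++ (replicate (leadingZeros b) 0)) ⟩
      length (replicate (leadingZeros b) 0 ++ h)        ≡⟨ cong length (sym (zeros++dropZeros b)) ⟩
      length b                                          ≡⟨ trans (length-omegaFrom m 0 c) len ⟩
      suc N                                             ∎
    zeros≡ : padding h ≡ leadingZeros b
    zeros≡ = trans (cong (λ n → suc n ∸ length h) cells-h) (trans (cong (_∸ length h) (sym split-length)) (NP.m+n∸n≡m _ (length h)))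

-- The equivalence class of a Ferrers board h: the boards of the m-paths
-- with the multiplicities of ν = ω_m(h).  All entries of ν are ≤ M = N m.
module Class (m : ℕ) (1≤m : 1 ≤ m) (h : List ℕ) (ferrers : IsFerrers h) where
  N = cells h
  ν = omega m h
  M = N * m

  ν-paths : List (List ℕ)
  ν-paths = paths m M (count ν)

  class : List (List ℕ)
  class = map (toBoard m) ν-paths

  ν-path-↭ : ∀ {c} → c ∈ ν-paths → c ↭ ν
  ν-path-↭ {c} c∈ = same-counts⇒↭ c ν same
    where
    open PathWith (paths-sound m M (count ν) c∈)
    same : ∀ i → count c i ≡ count ν i
    same i with i ≤? M
    ... | yes i≤M = counts i i≤M
    ... | no  i≰M = trans (bounded i (NP.≰⇒> i≰M)) (sym (count-above M ν i (omega-bound m h ferrers) (NP.≰⇒> i≰M)))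

  ν-path-board : ∀ {c} → c ∈ ν-paths → IsFerrers (toBoard m c) × omega m (toBoard m c) ≡ c
  ν-path-board {c} c∈ = omega-toBoard m N c path (trans (PermP.↭-length c↭ν) (length-omega m h ferrers)) cells≡
    where
    path = PathWith.path (paths-sound m M (count ν) c∈)
    c↭ν = ν-path-↭ c∈
    line : ℕ → ℕ
    line n = Σℕ (λ i → (0 + i) * m) n
    cells≡ : sum (omegaFrom m 0 c) ≡ N
    cells≡ = NP.+-cancelʳ-≡ (sum ν) _ _ (begin
      sum (omegaFrom m 0 c) + sum ν                ≡⟨ cong (_+_ (sum (omegaFrom m 0 c))) (sym (sum-↭ c↭ν)) ⟩
      sum (omegaFrom m 0 c) + sum c                ≡⟨ omegaFrom-sum m 0 c (mpath-underLine m c path) ⟩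
      line (length c)                              ≡⟨ cong line (PermP.↭-length c↭ν) ⟩
      line (length ν)                              ≡⟨ sym (omegaFrom-sum m 0 ν (mpath-underLine m ν (omega-mpath m h ferrers))) ⟩
      sum (omegaFrom m 0 ν) + sum ν                ≡⟨ cong (λ b → sum b + sum ν) ω-padded ⟩
      sum (padded h) + sum ν                       ≡⟨ cong (_+ sum ν) (sum-padded h) ⟩
      N + sum ν                                    ∎)
      where
      open ≡-Reasoning
      ω-padded : omegaFrom m 0 ν ≡ padded h
      ω-padded = trans (cong (omegaFrom m 0) (omega≡omegaFrom m h ferrers))
                       (omegaFrom-involutive m 0 (padded h) (underLine-padded m h 1≤m ferrers))

  class-unique : Unique class
  class-unique = unique-map-on (toBoard m) ν-paths (paths-unique m M (count ν))
    (λ p q e → trans (sym (proj₂ (ν-path-board p))) (trans (cong (omega m) e) (proj₂ (ν-path-board q))))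

  class-sound : ∀ h′ → h′ ∈ class → IsFerrers h′ × FileEquiv m h h′
  class-sound h′ mem with MP.∈-map⁻ (toBoard m) mem
  ... | c , c∈ , refl = proj₁ (ν-path-board c∈) ,
    omega-↭⇒equiv m h (toBoard m c) 1≤m ferrers (proj₁ (ν-path-board c∈))
      (subst (ν ↭_) (sym (proj₂ (ν-path-board c∈))) (↭-sym (ν-path-↭ c∈)))

  class-complete : ∀ h′ → IsFerrers h′ × FileEquiv m h h′ → h′ ∈ class
  class-complete h′ (ferrers′ , equiv) =
    subst (_∈ class) (toBoard-omega m h′ 1≤m ferrers′) (MP.∈-map⁺ (toBoard m) ω′∈)
    where
    ν↭ω′ = equiv⇒omega-↭ m h h′ 1≤m ferrers ferrers′ equiv
    ω′∈ : omega m h′ ∈ ν-paths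
    ω′∈ = paths-complete m M (count ν) (omega m h′) (record
      { path    = omega-mpath m h′ ferrers′
      ; counts  = λ i _ → sym (count-↭ ν↭ω′ i)
      ; bounded = λ i M<i → trans (sym (count-↭ ν↭ω′ i)) (count-above M ν i (omega-bound m h ferrers) M<i)
      })

  -- the class size is the product of binomials, indexed here by i < M
  factor : ℕ → ℕ
  factor i = (windowSum m (count ν) (suc i) ∸ 1) C count ν (suc i)

  class-size : length class ≡ classSize m h
  class-size = begin
    length class                                       ≡⟨ LP.length-map (toBoard m) ν-paths ⟩
    length ν-paths                                     ≡⟨ length-paths m M (count ν) ⟩
    Πℕ factor M                                        ≡⟨ at-least-one M refl ⟩
    Πℕ factor (suc (M ∸ 1))                            ≡⟨ sym (product-upTo factor (suc (M ∸ 1))) ⟩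
    product (map factor (upTo (suc (M ∸ 1))))          ≡⟨ cong product (LP.map-cong (λ i → cong (λ w → (w ∸ 1) C count ν (suc i)) (sym (window≡ (suc i)))) (upTo (suc (M ∸ 1)))) ⟩
    product (map (λ i → (window m ν (suc i) ∸ 1) C count ν (suc i)) (upTo (suc (M ∸ 1))))
                                                       ≡⟨ cong product (LP.map-∘ {g = λ i → (window m ν i ∸ 1) C count ν i} {f = suc} (upTo (suc (M ∸ 1)))) ⟩
    classSize m h                                      ∎
    where
    open ≡-Reasoning
    window≡ : ∀ i → window m ν i ≡ windowSum m (count ν) i
    window≡ i = trans (cong sum (sym (LP.map-∘ (upTo (suc (i ∸ (i ∸ m)))))))
                      (sum-upTo (λ t → count ν (i ∸ m + t)) (suc (i ∸ (i ∸ m))))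
    -- the range 1, …, M of Defs has at least one value; for M = 0 its factor is C(·, 0) = 1
    at-least-one : ∀ K → K ≡ M → Πℕ factor K ≡ Πℕ factor (suc (K ∸ 1))
    at-least-one (suc K) _   = refl
    at-least-one zero    K≡M = cong (1 *_) (sym (cong ((windowSum m (count ν) 1 ∸ 1) C_)
      (count-above M ν 1 (omega-bound m h ferrers) (subst (_< 1) K≡M (s≤s z≤n)))))

theorem8p1 : (m : ℕ) → 1 ≤ m → (h : List ℕ) → IsFerrers h →
    Σ (List (List ℕ)) (λ L →
      Unique L ×
      ((h′ : List ℕ) → (h′ ∈ L → IsFerrers h′ × FileEquiv m h h′) ×
                       (IsFerrers h′ × FileEquiv m h h′ → h′ ∈ L)) ×
      length L ≡ classSize m h)
theorem8p1 m 1≤m h ferrers = class , class-unique , (λ h′ → class-sound h′ , class-complete h′) , class-size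
  where open Class m 1≤m h ferrers
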